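{- For every integer $n\ge1$, the polynomial $\Omega(Z_{2n};t-\tfrac12)$ has constant coefficient equal to $R_{2n}$, the coefficient of $z^{2n}$ in $\sqrt{1-z^2/4}$, and its coefficient of $t^1$ equals $0$.
   Context: The zigzag poset $Z_m$ has ground set $\{z_1,\dots,z_m\}$ with cover relations $z_1>z_2<z_3>z_4<\cdots$. The order polynomial $\Omega(P;t)$ is the unique polynomial whose value at each positive integer $t$ is the number of order-preserving maps $P\to\{1,\dots,t\}$. -}

module Defs where

open import Data.Bool using (Bool; true; false; _∧_; _∨_; not)
open import Data.Nat using (ℕ; zero; suc; _≡ᵇ_; _≤ᵇ_; _%_; _≤_)
open import Relation.Binary.PropositionalEquality using (_≡_)
open import Data.Fin using (Fin; toℕ)
open import Data.Vec using (Vec; []; _∷_; lookup)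
open import Data.List using (List; []; _∷_; [_]; _++_; map; concatMap; allFin; filterᵇ; length; upTo; foldr)
open import Data.Integer using (+_)
open import Data.Rational using (ℚ; 0ℚ; 1ℚ; ½; -½; _+_; _*_; _-_; _/_)

-- The zigzag poset Z_m on {z_1,...,z_m}, with z_{k+1} represented by
-- the index k : Fin m (0-based).  Covers: z_1 > z_2 < z_3 > z_4 < ...,
-- i.e. the elements at even 0-based index are above their neighbours.

_<Z_ : ∀ {m} → Fin m → Fin m → Bool
i <Z j = ((toℕ j % 2) ≡ᵇ 0) ∧ ((toℕ i ≡ᵇ suc (toℕ j)) ∨ (suc (toℕ i) ≡ᵇ toℕ j))

-- partial order of Z_m (Z_m has height 1, so the order is just
-- equality or a cover relation)
_≤Z_ : ∀ {m} → Fin m → Fin m → Bool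
i ≤Z j = (toℕ i ≡ᵇ toℕ j) ∨ (i <Z j)

-- all maps {z_1..z_m} → {1..t}, as vectors over Fin t
-- (value k : Fin t stands for k+1 ∈ {1..t}, order is preserved)
allMaps : (t m : ℕ) → List (Vec (Fin t) m)
allMaps t zero    = [ [] ]
allMaps t (suc m) = concatMap (λ x → map (x ∷_) (allMaps t m)) (allFin t)

allᵇ : ∀ {A : Set} → (A → Bool) → List A → Bool
allᵇ p = foldr (λ a b → p a ∧ b) true

isOrderPreserving : ∀ {t m} → Vec (Fin t) m → Bool
isOrderPreserving {t} {m} f =
  allᵇ (λ i → allᵇ (λ j → not (i ≤Z j) ∨ (toℕ (lookup f i) ≤ᵇ toℕ (lookup f j)))
                 (allFin m))
      (allFin m)

ΩZcount : (m t : ℕ) → ℕ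
ΩZcount m t = length (filterᵇ isOrderPreserving (allMaps t m))

-- Polynomials over ℚ as coefficient lists (constant coefficient first)

Poly : Set
Poly = List ℚ

ℕ→ℚ : ℕ → ℚ
ℕ→ℚ n = + n / 1

eval : Poly → ℚ → ℚ
eval p x = foldr (λ a acc → a + x * acc) 0ℚ p

coeff : Poly → ℕ → ℚ
coeff []       _       = 0ℚ
coeff (a ∷ p)  zero    = a
coeff (a ∷ p)  (suc i) = coeff p i

addP : Poly → Poly → Poly
addP []      q       = q
addP (a ∷ p) []      = a ∷ p
addP (a ∷ p) (b ∷ q) = (a + b) ∷ addP p q

scaleP : ℚ → Poly → Poly
scaleP c = map (c *_)

mulTminusHalf : Poly → Poly
mulTminusHalf q = addP (0ℚ ∷ q) (scaleP -½ q)

shiftHalf : Poly → Poly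
shiftHalf = foldr (λ a acc → addP [ a ] (mulTminusHalf acc)) []

IsOrderPolyZ : ℕ → Poly → Set
IsOrderPolyZ m p = ∀ t → 1 ≤ t → eval p (ℕ→ℚ t) ≡ ℕ→ℚ (ΩZcount m t)

-- R_k : coefficient of z^k in the power series √(1 - z²/4), i.e. the
-- unique power series s with s₀ = 1 and s² = 1 - z²/4.  Its coefficients
-- are determined by  Σ_{i=0}^{k} s_i s_{k-i} = c_k, i.e.
--   s_k = (c_k - Σ_{i=1}^{k-1} s_i s_{k-i}) / 2   for k ≥ 1.

radicand : ℕ → ℚ
radicand zero                = 1ℚ
radicand (suc (suc zero))    = - (+ 1 / 4)
  where open import Data.Rational using (-_)
radicand _                   = 0ℚ

sumℚ : List ℚ → ℚ
sumℚ = foldr _+_ 0ℚ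

sqrtCoeffs : ℕ → List ℚ
sqrtCoeffs zero    = [ 1ℚ ]
sqrtCoeffs (suc k) = prev ++ [ ½ * (radicand (suc k) - sumℚ (map (λ i → coeff prev i * coeff prev (suc k Data.Nat.∸ i)) (map suc (upTo k)))) ]
  where prev = sqrtCoeffs k

R : ℕ → ℚ
R k = coeff (sqrtCoeffs k) k

{-# OPTIONS --safe #-}
-- Write β j y = (-1)^j binom(y + j, 2j), and for a height w let N_k(w) count the sequences of 2k values
-- in {0, …, t-1} which, preceded by w, form a zigzag starting with an up-step. Splitting off the first
-- two steps writes N_{k+1}(w) as Ω(Z_{2k+2}; t) minus a double partial sum of N_k, and the β j are
-- exactly the iterated partial sums, so N_k(w) = Σ_{j ≤ k} β j w · Ω(Z_{2k-2j}; t). At w = t no up-step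
-- is possible, so this vanishes for k ≥ 1: as power series in z, Σ_k Ω(Z_{2k}; t) z^k is the inverse of
-- Σ_j β j t z^j. Inverting Σ_j β j y z^j for a variable y therefore yields the order polynomials.
-- Since β j (-1 - y) = β j y they are symmetric about -1/2, so after the shift by 1/2 they are even and
-- have no linear term. At y = -1/2, (j + 1) β (j + 1) = (2j + 1) β j / 8, so Σ_j β j (-1/2) z^j is
-- (1 - z/4)^(-1/2), whose inverse √(1 - z/4) has z^n-coefficient R_{2n}.
module Submission where

open import Data.Bool using (Bool; true; false; _∧_; _∨_; not; if_then_else_)
open import Data.Bool.Properties using (∧-identityʳ; ∧-zeroʳ; T-≡)
open import Data.Fin using (Fin; toℕ) renaming (zero to fzero; suc to fsuc)
open import Data.Integer as ℤ using (+_)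
import Data.Integer.Properties as ℤ
open import Data.List
  using (List; []; _∷_; [_]; _++_; length; map; concat; filterᵇ; allFin; tabulate; upTo; applyUpTo)
open import Data.List.Properties using (filter-++; length-++; map-cong; map-∘; map-tabulate)
open import Data.List.Relation.Unary.All using (All; []; _∷_)
open import Data.Nat as ℕ using (ℕ; zero; suc; _∸_; _≡ᵇ_; _≤ᵇ_; _%_; z≤n; s≤s)
import Data.Nat.Coprimality as Coprime
import Data.Nat.Properties as ℕ
open import Data.Product using (Σ; _×_; _,_)
open import Data.Rational using (ℚ; 0ℚ; 1ℚ; ½; -½; _+_; _*_; _-_; -_; _/_; toℚᵘ)
import Data.Rational.Properties as ℚ
import Data.Rational.Unnormalised as ℚᵘ
import Data.Rational.Unnormalised.Properties as ℚᵘ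
open import Data.Sum using (inj₁; inj₂)
open import Data.Vec using (Vec; lookup) renaming ([] to []ᵛ; _∷_ to _∷ᵛ_)
open import Function using (_∘_)
open import Function.Bundles using (Equivalence)
open import Level using (0ℓ)
open import Relation.Binary.PropositionalEquality hiding ([_]; J)
open import Relation.Nullary.Decidable using (dec⇒maybe; T?)
import Tactic.RingSolver.Core.AlmostCommutativeRing as ACR
open import Tactic.RingSolver using (solve-∀)

open import Defs

ℚ-ring : ACR.AlmostCommutativeRing 0ℓ 0ℓ
ℚ-ring = ACR.fromCommutativeRing ℚ.+-*-commutativeRing (λ x → dec⇒maybe (0ℚ ℚ.≟ x))

toℚᵘ-ℕ→ℚ : ∀ n → toℚᵘ (ℕ→ℚ n) ≡ ℚᵘ.mkℚᵘ (+ n) 0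
toℚᵘ-ℕ→ℚ n = cong toℚᵘ (ℚ.normalize-coprime (Coprime.sym (Coprime.1-coprimeTo n)))

ℕ→ℚ-+ : ∀ m n → ℕ→ℚ (m ℕ.+ n) ≡ ℕ→ℚ m + ℕ→ℚ n
ℕ→ℚ-+ m n = ℚ.toℚᵘ-injective (begin
  toℚᵘ (ℕ→ℚ (m ℕ.+ n))                     ≡⟨ toℚᵘ-ℕ→ℚ (m ℕ.+ n) ⟩
  ℚᵘ.mkℚᵘ (+ (m ℕ.+ n)) 0                  ≡⟨ cong (λ i → ℚᵘ.mkℚᵘ i 0) +[m+n]≡+m*1+n*1 ⟩
  ℚᵘ.mkℚᵘ (+ m) 0 ℚᵘ.+ ℚᵘ.mkℚᵘ (+ n) 0     ≡⟨ cong₂ ℚᵘ._+_ (toℚᵘ-ℕ→ℚ m) (toℚᵘ-ℕ→ℚ n) ⟨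
  toℚᵘ (ℕ→ℚ m) ℚᵘ.+ toℚᵘ (ℕ→ℚ n)           ≈⟨ ℚ.toℚᵘ-homo-+ (ℕ→ℚ m) (ℕ→ℚ n) ⟨
  toℚᵘ (ℕ→ℚ m + ℕ→ℚ n)                     ∎)
  where
  open ℚᵘ.≃-Reasoning
  +[m+n]≡+m*1+n*1 : + (m ℕ.+ n) ≡ + m ℤ.* + 1 ℤ.+ + n ℤ.* + 1
  +[m+n]≡+m*1+n*1 = trans (ℤ.pos-+ m n) (sym (cong₂ ℤ._+_ (ℤ.*-identityʳ (+ m)) (ℤ.*-identityʳ (+ n))))

ℕ→ℚ-suc : ∀ n → ℕ→ℚ (suc n) ≡ 1ℚ + ℕ→ℚ n
ℕ→ℚ-suc = ℕ→ℚ-+ 1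

ℕ→ℚ-suc′ : ∀ n → ℕ→ℚ (suc n) ≡ ℕ→ℚ n + 1ℚ
ℕ→ℚ-suc′ n = trans (ℕ→ℚ-suc n) (ℚ.+-comm 1ℚ (ℕ→ℚ n))

ℕ→ℚ-suc-inverse : ∀ n → ℕ→ℚ (suc n) * (+ 1 / suc n) ≡ 1ℚ
ℕ→ℚ-suc-inverse n = ℚ.toℚᵘ-injective (begin
  toℚᵘ (ℕ→ℚ (suc n) * (+ 1 / suc n))            ≈⟨ ℚ.toℚᵘ-homo-* (ℕ→ℚ (suc n)) (+ 1 / suc n) ⟩
  toℚᵘ (ℕ→ℚ (suc n)) ℚᵘ.* toℚᵘ (+ 1 / suc n)    ≡⟨ cong₂ ℚᵘ._*_ (toℚᵘ-ℕ→ℚ (suc n)) toℚᵘ-1/suc ⟩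
  ℚᵘ.mkℚᵘ (+ suc n) 0 ℚᵘ.* ℚᵘ.mkℚᵘ (+ 1) n      ≈⟨ ℚᵘ.*≡* cross-multiplied ⟩
  ℚᵘ.mkℚᵘ (+ 1) 0                               ∎)
  where
  open ℚᵘ.≃-Reasoning
  toℚᵘ-1/suc : toℚᵘ (+ 1 / suc n) ≡ ℚᵘ.mkℚᵘ (+ 1) n
  toℚᵘ-1/suc = cong toℚᵘ (ℚ.normalize-coprime (Coprime.1-coprimeTo (suc n)))
  cross-multiplied : + suc n ℤ.* + 1 ℤ.* + 1 ≡ + 1 ℤ.* + suc (n ℕ.+ 0)
  cross-multiplied =
    trans (ℤ.*-identityʳ (+ suc n ℤ.* + 1)) (trans (ℤ.*-identityʳ (+ suc n))
      (sym (trans (ℤ.*-identityˡ (+ suc (n ℕ.+ 0))) (cong (+_ ∘ suc) (ℕ.+-identityʳ n)))))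

ℕ→ℚ-suc-cancel : ∀ k q → ℕ→ℚ (suc k) * q ≡ 0ℚ → q ≡ 0ℚ
ℕ→ℚ-suc-cancel k q kq≡0 = begin
  q                                    ≡⟨ ℚ.*-identityˡ q ⟨
  1ℚ * q                               ≡⟨ cong (_* q) (ℕ→ℚ-suc-inverse k) ⟨
  ℕ→ℚ (suc k) * (+ 1 / suc k) * q      ≡⟨ reassoc (ℕ→ℚ (suc k)) (+ 1 / suc k) q ⟩
  (+ 1 / suc k) * (ℕ→ℚ (suc k) * q)    ≡⟨ cong ((+ 1 / suc k) *_) kq≡0 ⟩
  (+ 1 / suc k) * 0ℚ                   ≡⟨ ℚ.*-zeroʳ (+ 1 / suc k) ⟩
  0ℚ                                   ∎
  where
  open ≡-Reasoning
  reassoc : ∀ a b c → a * b * c ≡ b * (a * c)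
  reassoc = solve-∀ ℚ-ring

-- Polynomials

eval-addP : ∀ p q x → eval (addP p q) x ≡ eval p x + eval q x
eval-addP []      q       x = sym (ℚ.+-identityˡ _)
eval-addP (a ∷ p) []      x = sym (ℚ.+-identityʳ _)
eval-addP (a ∷ p) (b ∷ q) x = begin
  (a + b) + x * eval (addP p q) x         ≡⟨ cong (λ e → (a + b) + x * e) (eval-addP p q x) ⟩
  (a + b) + x * (eval p x + eval q x)     ≡⟨ regroup a b x (eval p x) (eval q x) ⟩
  (a + x * eval p x) + (b + x * eval q x) ∎
  where
  open ≡-Reasoning
  regroup : ∀ a b x u v → (a + b) + x * (u + v) ≡ (a + x * u) + (b + x * v)
  regroup = solve-∀ ℚ-ring

eval-scaleP : ∀ c p x → eval (scaleP c p) x ≡ c * eval p x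
eval-scaleP c []      x = sym (ℚ.*-zeroʳ c)
eval-scaleP c (a ∷ p) x = begin
  c * a + x * eval (scaleP c p) x ≡⟨ cong (λ e → c * a + x * e) (eval-scaleP c p x) ⟩
  c * a + x * (c * eval p x)      ≡⟨ factor c a x (eval p x) ⟩
  c * (a + x * eval p x)          ∎
  where
  open ≡-Reasoning
  factor : ∀ c a x u → c * a + x * (c * u) ≡ c * (a + x * u)
  factor = solve-∀ ℚ-ring

mulP : Poly → Poly → Poly
mulP []      q = []
mulP (a ∷ p) q = addP (scaleP a q) (0ℚ ∷ mulP p q)

eval-mulP : ∀ p q x → eval (mulP p q) x ≡ eval p x * eval q x
eval-mulP []      q x = sym (ℚ.*-zeroˡ (eval q x))
eval-mulP (a ∷ p) q x = begin
  eval (addP (scaleP a q) (0ℚ ∷ mulP p q)) x           ≡⟨ eval-addP (scaleP a q) (0ℚ ∷ mulP p q) x ⟩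
  eval (scaleP a q) x + (0ℚ + x * eval (mulP p q) x)  ≡⟨ cong₂ (λ u v → u + (0ℚ + x * v)) (eval-scaleP a q x) (eval-mulP p q x) ⟩
  a * eval q x + (0ℚ + x * (eval p x * eval q x))     ≡⟨ factor a x (eval p x) (eval q x) ⟩
  (a + x * eval p x) * eval q x                       ∎
  where
  open ≡-Reasoning
  factor : ∀ a x u v → a * v + (0ℚ + x * (u * v)) ≡ (a + x * u) * v
  factor = solve-∀ ℚ-ring

eval-mulTminusHalf : ∀ q x → eval (mulTminusHalf q) x ≡ (x + -½) * eval q x
eval-mulTminusHalf q x = begin
  eval (addP (0ℚ ∷ q) (scaleP -½ q)) x       ≡⟨ eval-addP (0ℚ ∷ q) (scaleP -½ q) x ⟩
  (0ℚ + x * eval q x) + eval (scaleP -½ q) x ≡⟨ cong (λ e → (0ℚ + x * eval q x) + e) (eval-scaleP -½ q x) ⟩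
  (0ℚ + x * eval q x) + -½ * eval q x        ≡⟨ factor x (eval q x) ⟩
  (x + -½) * eval q x                        ∎
  where
  open ≡-Reasoning
  factor : ∀ x u → (0ℚ + x * u) + -½ * u ≡ (x + -½) * u
  factor = solve-∀ ℚ-ring

eval-shiftHalf : ∀ p x → eval (shiftHalf p) x ≡ eval p (x + -½)
eval-shiftHalf []      x = refl
eval-shiftHalf (a ∷ p) x = begin
  eval (addP [ a ] (mulTminusHalf (shiftHalf p))) x      ≡⟨ eval-addP [ a ] (mulTminusHalf (shiftHalf p)) x ⟩
  (a + x * 0ℚ) + eval (mulTminusHalf (shiftHalf p)) x   ≡⟨ cong (λ e → (a + x * 0ℚ) + e) (eval-mulTminusHalf (shiftHalf p) x) ⟩
  (a + x * 0ℚ) + (x + -½) * eval (shiftHalf p) x        ≡⟨ cong (λ e → (a + x * 0ℚ) + (x + -½) * e) (eval-shiftHalf p x) ⟩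
  (a + x * 0ℚ) + (x + -½) * eval p (x + -½)             ≡⟨ drop-x*0 a x ((x + -½) * eval p (x + -½)) ⟩
  a + (x + -½) * eval p (x + -½)                        ∎
  where
  open ≡-Reasoning
  drop-x*0 : ∀ a x u → (a + x * 0ℚ) + u ≡ a + u
  drop-x*0 = solve-∀ ℚ-ring

coeff-zero-eval : ∀ p → coeff p 0 ≡ eval p 0ℚ
coeff-zero-eval []      = refl
coeff-zero-eval (a ∷ p) = sym (a+0*u≡a a (eval p 0ℚ))
  where
  a+0*u≡a : ∀ a u → a + 0ℚ * u ≡ a
  a+0*u≡a = solve-∀ ℚ-ring

coeff-addP : ∀ p q k → coeff (addP p q) k ≡ coeff p k + coeff q k
coeff-addP []      q       k       = sym (ℚ.+-identityˡ _)
coeff-addP (a ∷ p) []      zero    = sym (ℚ.+-identityʳ a)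
coeff-addP (a ∷ p) []      (suc k) = sym (ℚ.+-identityʳ _)
coeff-addP (a ∷ p) (b ∷ q) zero    = refl
coeff-addP (a ∷ p) (b ∷ q) (suc k) = coeff-addP p q k

coeff-scaleP : ∀ c p k → coeff (scaleP c p) k ≡ c * coeff p k
coeff-scaleP c []      k       = sym (ℚ.*-zeroʳ c)
coeff-scaleP c (a ∷ p) zero    = refl
coeff-scaleP c (a ∷ p) (suc k) = coeff-scaleP c p k

subP : Poly → Poly → Poly
subP p q = addP p (scaleP (- 1ℚ) q)

eval-subP : ∀ p q x → eval (subP p q) x ≡ eval p x - eval q x
eval-subP p q x = begin
  eval (addP p (scaleP (- 1ℚ) q)) x  ≡⟨ eval-addP p (scaleP (- 1ℚ) q) x ⟩
  eval p x + eval (scaleP (- 1ℚ) q) x ≡⟨ cong (λ e → eval p x + e) (eval-scaleP (- 1ℚ) q x) ⟩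
  eval p x + - 1ℚ * eval q x          ≡⟨ u+-1*v≡u-v (eval p x) (eval q x) ⟩
  eval p x - eval q x                 ∎
  where
  open ≡-Reasoning
  u+-1*v≡u-v : ∀ u v → u + - 1ℚ * v ≡ u - v
  u+-1*v≡u-v = solve-∀ ℚ-ring

IsZeroPoly : Poly → Set
IsZeroPoly = All (_≡ 0ℚ)

eval-IsZeroPoly : ∀ {p} → IsZeroPoly p → ∀ x → eval p x ≡ 0ℚ
eval-IsZeroPoly []           x = refl
eval-IsZeroPoly {a ∷ p} (a≡0 ∷ p≡0) x = begin
  a + x * eval p x ≡⟨ cong₂ (λ a e → a + x * e) a≡0 (eval-IsZeroPoly p≡0 x) ⟩
  0ℚ + x * 0ℚ      ≡⟨ ℚ.+-identityˡ (x * 0ℚ) ⟩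
  x * 0ℚ           ≡⟨ ℚ.*-zeroʳ x ⟩
  0ℚ               ∎
  where open ≡-Reasoning

coeff-IsZeroPoly : ∀ {p} → IsZeroPoly p → ∀ k → coeff p k ≡ 0ℚ
coeff-IsZeroPoly []          k       = refl
coeff-IsZeroPoly (a≡0 ∷ _)   zero    = a≡0
coeff-IsZeroPoly (_ ∷ p≡0)   (suc k) = coeff-IsZeroPoly p≡0 k

a+c*0≡a : ∀ a c → a + c * 0ℚ ≡ a
a+c*0≡a = solve-∀ ℚ-ring

-- (p - p(c)) / (X - c)
quotientBy : ℚ → Poly → Poly
quotientBy c []          = []
quotientBy c (a ∷ [])    = []
quotientBy c (a ∷ b ∷ p) = eval (b ∷ p) c ∷ quotientBy c (b ∷ p)

eval-quotientBy : ∀ c p x → eval p x ≡ (x - c) * eval (quotientBy c p) x + eval p c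
eval-quotientBy c []          x = identity x c
  where
  identity : ∀ x c → 0ℚ ≡ (x - c) * 0ℚ + 0ℚ
  identity = solve-∀ ℚ-ring
eval-quotientBy c (a ∷ [])    x = identity a x c
  where
  identity : ∀ a x c → a + x * 0ℚ ≡ (x - c) * 0ℚ + (a + c * 0ℚ)
  identity = solve-∀ ℚ-ring
eval-quotientBy c (a ∷ b ∷ p) x = begin
  a + x * eval (b ∷ p) x                 ≡⟨ cong (λ e → a + x * e) (eval-quotientBy c (b ∷ p) x) ⟩
  a + x * ((x - c) * q + r)              ≡⟨ identity a c x q r ⟩
  (x - c) * (r + x * q) + (a + c * r)    ∎
  where
  open ≡-Reasoning
  q : ℚ
  q = eval (quotientBy c (b ∷ p)) x
  r : ℚ
  r = eval (b ∷ p) c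
  identity : ∀ a c x q r → a + x * ((x - c) * q + r) ≡ (x - c) * (r + x * q) + (a + c * r)
  identity = solve-∀ ℚ-ring

length-quotientBy : ∀ c a p → length (quotientBy c (a ∷ p)) ≡ length p
length-quotientBy c a []      = refl
length-quotientBy c a (b ∷ p) = cong suc (length-quotientBy c b p)

IsZeroPoly-quotientBy : ∀ c p → IsZeroPoly (quotientBy c p) → eval p c ≡ 0ℚ → IsZeroPoly p
IsZeroPoly-quotientBy c []          _            _      = []
IsZeroPoly-quotientBy c (a ∷ [])    _            pc≡0   = trans (sym (a+c*0≡a a c)) pc≡0 ∷ []
IsZeroPoly-quotientBy c (a ∷ b ∷ p) (r≡0 ∷ q≡0) pc≡0 =
  trans (sym (a+c*0≡a a c)) (trans (cong (λ r → a + c * r) (sym r≡0)) pc≡0)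
  ∷ IsZeroPoly-quotientBy c (b ∷ p) q≡0 r≡0

vanishing⇒IsZeroPoly : ∀ L p c → length p ℕ.≤ L →
  (∀ n → c ℕ.≤ n → eval p (ℕ→ℚ n) ≡ 0ℚ) → IsZeroPoly p
vanishing⇒IsZeroPoly L       []      c _           _    = []
vanishing⇒IsZeroPoly (suc L) (a ∷ p) c (s≤s |p|≤L) p≡0 =
  IsZeroPoly-quotientBy (ℕ→ℚ c) (a ∷ p)
    (vanishing⇒IsZeroPoly L q (suc c) (subst (ℕ._≤ L) (sym (length-quotientBy (ℕ→ℚ c) a p)) |p|≤L) q≡0)
    (p≡0 c ℕ.≤-refl)
  where
  q : Poly
  q = quotientBy (ℕ→ℚ c) (a ∷ p)
  q≡0 : ∀ n → suc c ℕ.≤ n → eval q (ℕ→ℚ n) ≡ 0ℚ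
  q≡0 n c<n with ℕ.m≤n⇒∃[o]m+o≡n c<n
  ... | k , refl = ℕ→ℚ-suc-cancel k (eval q x) (begin
    ℕ→ℚ (suc k) * eval q x                          ≡⟨ cong (_* eval q x) distance ⟨
    (x - ℕ→ℚ c) * eval q x                          ≡⟨ ℚ.+-identityʳ _ ⟨
    (x - ℕ→ℚ c) * eval q x + 0ℚ                     ≡⟨ cong (λ e → (x - ℕ→ℚ c) * eval q x + e) (p≡0 c ℕ.≤-refl) ⟨
    (x - ℕ→ℚ c) * eval q x + eval (a ∷ p) (ℕ→ℚ c)   ≡⟨ eval-quotientBy (ℕ→ℚ c) (a ∷ p) x ⟨
    eval (a ∷ p) x                                  ≡⟨ p≡0 (suc c ℕ.+ k) (ℕ.m≤n⇒m≤1+n (ℕ.m≤m+n c k)) ⟩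
    0ℚ                                              ∎)
    where
    open ≡-Reasoning
    x : ℚ
    x = ℕ→ℚ (suc c ℕ.+ k)
    a+b-b≡a : ∀ a b → a + b - b ≡ a
    a+b-b≡a = solve-∀ ℚ-ring
    distance : x - ℕ→ℚ c ≡ ℕ→ℚ (suc k)
    distance = begin
      ℕ→ℚ (suc c ℕ.+ k) - ℕ→ℚ c         ≡⟨ cong (λ n → ℕ→ℚ (suc n) - ℕ→ℚ c) (ℕ.+-comm c k) ⟩
      ℕ→ℚ (suc k ℕ.+ c) - ℕ→ℚ c         ≡⟨ cong (_- ℕ→ℚ c) (ℕ→ℚ-+ (suc k) c) ⟩
      ℕ→ℚ (suc k) + ℕ→ℚ c - ℕ→ℚ c       ≡⟨ a+b-b≡a (ℕ→ℚ (suc k)) (ℕ→ℚ c) ⟩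
      ℕ→ℚ (suc k)                       ∎

eval-unique : ∀ p q c → (∀ n → c ℕ.≤ n → eval p (ℕ→ℚ n) ≡ eval q (ℕ→ℚ n)) →
  ∀ x → eval p x ≡ eval q x
eval-unique p q c p≡q x = begin
  eval p x                       ≡⟨ a-b+b≡a (eval p x) (eval q x) ⟨
  eval p x - eval q x + eval q x ≡⟨ cong (_+ eval q x) (eval-subP p q x) ⟨
  eval (subP p q) x + eval q x   ≡⟨ cong (_+ eval q x) (eval-IsZeroPoly p-q≡0 x) ⟩
  0ℚ + eval q x                  ≡⟨ ℚ.+-identityˡ (eval q x) ⟩
  eval q x                       ∎
  where
  open ≡-Reasoning
  a-b+b≡a : ∀ a b → a - b + b ≡ a
  a-b+b≡a = solve-∀ ℚ-ring
  p-q≡0 : IsZeroPoly (subP p q)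
  p-q≡0 = vanishing⇒IsZeroPoly _ (subP p q) c ℕ.≤-refl λ n c≤n →
    trans (eval-subP p q (ℕ→ℚ n)) (trans (cong (_- eval q (ℕ→ℚ n)) (p≡q n c≤n)) (ℚ.+-inverseʳ (eval q (ℕ→ℚ n))))

reflectP : Poly → Poly
reflectP []      = []
reflectP (a ∷ p) = a ∷ scaleP (- 1ℚ) (reflectP p)

eval-reflectP : ∀ p x → eval (reflectP p) x ≡ eval p (- x)
eval-reflectP []      x = refl
eval-reflectP (a ∷ p) x = begin
  a + x * eval (scaleP (- 1ℚ) (reflectP p)) x  ≡⟨ cong (λ e → a + x * e) (eval-scaleP (- 1ℚ) (reflectP p) x) ⟩
  a + x * (- 1ℚ * eval (reflectP p) x)         ≡⟨ cong (λ e → a + x * (- 1ℚ * e)) (eval-reflectP p x) ⟩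
  a + x * (- 1ℚ * eval p (- x))                ≡⟨ identity a x (eval p (- x)) ⟩
  a + (- x) * eval p (- x)                     ∎
  where
  open ≡-Reasoning
  identity : ∀ a x u → a + x * (- 1ℚ * u) ≡ a + (- x) * u
  identity = solve-∀ ℚ-ring

coeff1-reflectP : ∀ p → coeff (reflectP p) 1 ≡ - 1ℚ * coeff p 1
coeff1-reflectP []          = refl
coeff1-reflectP (a ∷ [])    = refl
coeff1-reflectP (a ∷ b ∷ p) = refl

even⇒coeff1≡0 : ∀ q → (∀ x → eval q (- x) ≡ eval q x) → coeff q 1 ≡ 0ℚ
even⇒coeff1≡0 q even = begin
  c                                     ≡⟨ half-double c ⟨
  ½ * (c + - 1ℚ * (- 1ℚ * c))           ≡⟨ cong (λ e → ½ * (c + - 1ℚ * e)) (coeff1-reflectP q) ⟨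
  ½ * (c + - 1ℚ * coeff (reflectP q) 1) ≡⟨ cong (λ e → ½ * (c + e)) (coeff-scaleP (- 1ℚ) (reflectP q) 1) ⟨
  ½ * (c + coeff (scaleP (- 1ℚ) (reflectP q)) 1)
                                        ≡⟨ cong (½ *_) (coeff-addP q (scaleP (- 1ℚ) (reflectP q)) 1) ⟨
  ½ * coeff (subP q (reflectP q)) 1     ≡⟨ cong (½ *_) (coeff-IsZeroPoly q-q̄≡0 1) ⟩
  ½ * 0ℚ                                ≡⟨ ℚ.*-zeroʳ ½ ⟩
  0ℚ                                    ∎
  where
  open ≡-Reasoning
  c : ℚ
  c = coeff q 1
  half-double : ∀ c → ½ * (c + - 1ℚ * (- 1ℚ * c)) ≡ c
  half-double = solve-∀ ℚ-ring
  q-q̄≡0 : IsZeroPoly (subP q (reflectP q))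
  q-q̄≡0 = vanishing⇒IsZeroPoly _ (subP q (reflectP q)) 0 ℕ.≤-refl λ n _ → begin
    eval (subP q (reflectP q)) (ℕ→ℚ n)        ≡⟨ eval-subP q (reflectP q) (ℕ→ℚ n) ⟩
    eval q (ℕ→ℚ n) - eval (reflectP q) (ℕ→ℚ n)
                                              ≡⟨ cong (λ e → eval q (ℕ→ℚ n) - e) (trans (eval-reflectP q (ℕ→ℚ n)) (even (ℕ→ℚ n))) ⟩
    eval q (ℕ→ℚ n) - eval q (ℕ→ℚ n)           ≡⟨ ℚ.+-inverseʳ (eval q (ℕ→ℚ n)) ⟩
    0ℚ                                        ∎

-- Finite sums and Cauchy products

∑< : ℕ → (ℕ → ℚ) → ℚ
∑< zero    f = 0ℚ
∑< (suc n) f = f 0 + ∑< n (f ∘ suc)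

syntax ∑< n (λ i → e) = ∑[ i < n ] e

∑-cong : ∀ n {f g : ℕ → ℚ} → (∀ i → i ℕ.< n → f i ≡ g i) → ∑< n f ≡ ∑< n g
∑-cong zero    f≡g = refl
∑-cong (suc n) f≡g = cong₂ _+_ (f≡g 0 (s≤s z≤n)) (∑-cong n (λ i i<n → f≡g (suc i) (s≤s i<n)))

∑-distrib-+ : ∀ n (f g : ℕ → ℚ) → ∑[ i < n ] (f i + g i) ≡ ∑< n f + ∑< n g
∑-distrib-+ zero    f g = refl
∑-distrib-+ (suc n) f g = begin
  (f 0 + g 0) + ∑[ i < n ] (f (suc i) + g (suc i))  ≡⟨ cong (λ e → (f 0 + g 0) + e) (∑-distrib-+ n (f ∘ suc) (g ∘ suc)) ⟩
  (f 0 + g 0) + (∑< n (f ∘ suc) + ∑< n (g ∘ suc))   ≡⟨ interchange (f 0) (g 0) _ _ ⟩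
  (f 0 + ∑< n (f ∘ suc)) + (g 0 + ∑< n (g ∘ suc))   ∎
  where
  open ≡-Reasoning
  interchange : ∀ a b c d → (a + b) + (c + d) ≡ (a + c) + (b + d)
  interchange = solve-∀ ℚ-ring

∑-distribˡ : ∀ n (f : ℕ → ℚ) c → ∑[ i < n ] (c * f i) ≡ c * ∑< n f
∑-distribˡ zero    f c = sym (ℚ.*-zeroʳ c)
∑-distribˡ (suc n) f c =
  trans (cong (λ e → c * f 0 + e) (∑-distribˡ n (f ∘ suc) c)) (sym (ℚ.*-distribˡ-+ c (f 0) _))

∑-distribʳ : ∀ n (f : ℕ → ℚ) c → ∑[ i < n ] (f i * c) ≡ ∑< n f * c
∑-distribʳ zero    f c = sym (ℚ.*-zeroˡ c)
∑-distribʳ (suc n) f c =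
  trans (cong (λ e → f 0 * c + e) (∑-distribʳ n (f ∘ suc) c)) (sym (ℚ.*-distribʳ-+ c (f 0) _))

∑-zero : ∀ n → ∑[ i < n ] 0ℚ ≡ 0ℚ
∑-zero zero    = refl
∑-zero (suc n) = trans (ℚ.+-identityˡ _) (∑-zero n)

∑-comm : ∀ m n (h : ℕ → ℕ → ℚ) → ∑[ i < m ] ∑[ j < n ] h i j ≡ ∑[ j < n ] ∑[ i < m ] h i j
∑-comm zero    n h = sym (∑-zero n)
∑-comm (suc m) n h = begin
  ∑[ j < n ] h 0 j + ∑[ i < m ] ∑[ j < n ] h (suc i) j  ≡⟨ cong (λ e → ∑[ j < n ] h 0 j + e) (∑-comm m n (h ∘ suc)) ⟩
  ∑[ j < n ] h 0 j + ∑[ j < n ] ∑[ i < m ] h (suc i) j  ≡⟨ ∑-distrib-+ n (h 0) (λ j → ∑[ i < m ] h (suc i) j) ⟨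
  ∑[ j < n ] (h 0 j + ∑[ i < m ] h (suc i) j)           ∎
  where open ≡-Reasoning

∑-init-last : ∀ n (f : ℕ → ℚ) → ∑< (suc n) f ≡ ∑< n f + f n
∑-init-last zero    f = trans (ℚ.+-identityʳ (f 0)) (sym (ℚ.+-identityˡ (f 0)))
∑-init-last (suc n) f =
  trans (cong (λ e → f 0 + e) (∑-init-last n (f ∘ suc))) (sym (ℚ.+-assoc (f 0) _ _))

∑-reverse : ∀ n (f : ℕ → ℚ) → ∑< n f ≡ ∑[ i < n ] f (n ∸ suc i)
∑-reverse zero    f = refl
∑-reverse (suc n) f = begin
  ∑< (suc n) f                      ≡⟨ ∑-init-last n f ⟩
  ∑< n f + f n                      ≡⟨ cong (_+ f n) (∑-reverse n f) ⟩
  ∑[ i < n ] f (n ∸ suc i) + f n    ≡⟨ ℚ.+-comm _ (f n) ⟩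
  f n + ∑[ i < n ] f (n ∸ suc i)    ∎
  where open ≡-Reasoning

infixl 7 _⋆_

_⋆_ : (ℕ → ℚ) → (ℕ → ℚ) → ℕ → ℚ
(c ⋆ f) k = ∑[ j < suc k ] (c j * f (k ∸ j))

⋆-comm : ∀ c f k → (c ⋆ f) k ≡ (f ⋆ c) k
⋆-comm c f k = trans (∑-reverse (suc k) (λ j → c j * f (k ∸ j))) (∑-cong (suc k) reindex)
  where
  reindex : ∀ i → i ℕ.< suc k → c (k ∸ i) * f (k ∸ (k ∸ i)) ≡ f i * c (k ∸ i)
  reindex i i<1+k = trans (cong (λ j → c (k ∸ i) * f j) (ℕ.m∸[m∸n]≡n (ℕ.≤-pred i<1+k))) (ℚ.*-comm (c (k ∸ i)) (f i))

⋆-congˡ : ∀ {c d} f k → (∀ i → i ℕ.≤ k → c i ≡ d i) → (c ⋆ f) k ≡ (d ⋆ f) k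
⋆-congˡ f k c≡d = ∑-cong (suc k) (λ i i<1+k → cong (_* f (k ∸ i)) (c≡d i (ℕ.≤-pred i<1+k)))

⋆-congʳ : ∀ c {f g} k → (∀ i → i ℕ.≤ k → f i ≡ g i) → (c ⋆ f) k ≡ (c ⋆ g) k
⋆-congʳ c k f≡g = ∑-cong (suc k) (λ i _ → cong (c i *_) (f≡g (k ∸ i) (ℕ.m∸n≤m k i)))

⋆-distribʳ-+ : ∀ a b f k → ((λ j → a j + b j) ⋆ f) k ≡ (a ⋆ f) k + (b ⋆ f) k
⋆-distribʳ-+ a b f k =
  trans (∑-cong (suc k) (λ i _ → ℚ.*-distribʳ-+ (f (k ∸ i)) (a i) (b i)))
        (∑-distrib-+ (suc k) (λ j → a j * f (k ∸ j)) (λ j → b j * f (k ∸ j)))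

⋆-assoc-scalar : ∀ s a f k → ((λ j → s * a j) ⋆ f) k ≡ s * (a ⋆ f) k
⋆-assoc-scalar s a f k =
  trans (∑-cong (suc k) (λ i _ → ℚ.*-assoc s (a i) (f (k ∸ i))))
        (∑-distribˡ (suc k) (λ j → a j * f (k ∸ j)) s)

∑-⋆ : ∀ n (c : ℕ → ℕ → ℚ) f k → ∑[ a < n ] (c a ⋆ f) k ≡ ((λ j → ∑[ a < n ] c a j) ⋆ f) k
∑-⋆ n c f k = trans (∑-comm n (suc k) (λ a j → c a j * f (k ∸ j)))
                    (∑-cong (suc k) (λ j _ → ∑-distribʳ n (λ a → c a j) (f (k ∸ j))))

⋆-suc : ∀ c f k → c 0 ≡ 1ℚ → (c ⋆ f) (suc k) ≡ 0ℚ → f (suc k) ≡ - ((c ∘ suc) ⋆ f) k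
⋆-suc c f k c₀≡1 c⋆f≡0 = begin
  f (suc k)                  ≡⟨ solve-for (f (suc k)) X ⟨
  1ℚ * f (suc k) + X - X     ≡⟨ cong (λ a → a * f (suc k) + X - X) c₀≡1 ⟨
  (c ⋆ f) (suc k) - X        ≡⟨ cong (_- X) c⋆f≡0 ⟩
  0ℚ - X                     ≡⟨ ℚ.+-identityˡ (- X) ⟩
  - X                        ∎
  where
  open ≡-Reasoning
  X : ℚ
  X = ((c ∘ suc) ⋆ f) k
  solve-for : ∀ a b → 1ℚ * a + b - b ≡ a
  solve-for = solve-∀ ℚ-ring

⋆-inverse-unique : ∀ c f g → c 0 ≡ 1ℚ → f 0 ≡ g 0 →
  (∀ k → (c ⋆ f) (suc k) ≡ 0ℚ) → (∀ k → (c ⋆ g) (suc k) ≡ 0ℚ) → ∀ n → f n ≡ g n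
⋆-inverse-unique c f g c₀≡1 f₀≡g₀ c⋆f≡0 c⋆g≡0 n = agree-upto n n ℕ.≤-refl
  where
  agree-upto : ∀ n i → i ℕ.≤ n → f i ≡ g i
  agree-upto zero    .zero z≤n = f₀≡g₀
  agree-upto (suc n) i   i≤1+n with ℕ.m≤n⇒m<n∨m≡n i≤1+n
  ... | inj₁ i<1+n = agree-upto n i (ℕ.≤-pred i<1+n)
  ... | inj₂ refl  = begin
    f (suc n)                 ≡⟨ ⋆-suc c f n c₀≡1 (c⋆f≡0 n) ⟩
    - ((c ∘ suc) ⋆ f) n       ≡⟨ cong -_ (⋆-congʳ (c ∘ suc) n (agree-upto n)) ⟩
    - ((c ∘ suc) ⋆ g) n       ≡⟨ ⋆-suc c g n c₀≡1 (c⋆g≡0 n) ⟨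
    g (suc n)                 ∎
    where open ≡-Reasoning

-- The polynomials β j

1/[1+2j] : ℕ → ℚ
1/[1+2j] j = + 1 / suc (j ℕ.+ j)

1/[2+2j] : ℕ → ℚ
1/[2+2j] j = + 1 / suc (suc (j ℕ.+ j))

[1+2j]*1/[1+2j] : ∀ j → (1ℚ + (ℕ→ℚ j + ℕ→ℚ j)) * 1/[1+2j] j ≡ 1ℚ
[1+2j]*1/[1+2j] j = begin
  (1ℚ + (ℕ→ℚ j + ℕ→ℚ j)) * 1/[1+2j] j  ≡⟨ cong (λ e → (1ℚ + e) * 1/[1+2j] j) (ℕ→ℚ-+ j j) ⟨
  (1ℚ + ℕ→ℚ (j ℕ.+ j)) * 1/[1+2j] j    ≡⟨ cong (_* 1/[1+2j] j) (ℕ→ℚ-suc (j ℕ.+ j)) ⟨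
  ℕ→ℚ (suc (j ℕ.+ j)) * 1/[1+2j] j     ≡⟨ ℕ→ℚ-suc-inverse (j ℕ.+ j) ⟩
  1ℚ                                   ∎
  where open ≡-Reasoning

[2+2j]*1/[2+2j] : ∀ j → (1ℚ + (1ℚ + (ℕ→ℚ j + ℕ→ℚ j))) * 1/[2+2j] j ≡ 1ℚ
[2+2j]*1/[2+2j] j = begin
  (1ℚ + (1ℚ + (ℕ→ℚ j + ℕ→ℚ j))) * 1/[2+2j] j  ≡⟨ cong (λ e → (1ℚ + (1ℚ + e)) * 1/[2+2j] j) (ℕ→ℚ-+ j j) ⟨
  (1ℚ + (1ℚ + ℕ→ℚ (j ℕ.+ j))) * 1/[2+2j] j    ≡⟨ cong (λ e → (1ℚ + e) * 1/[2+2j] j) (ℕ→ℚ-suc (j ℕ.+ j)) ⟨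
  (1ℚ + ℕ→ℚ (suc (j ℕ.+ j))) * 1/[2+2j] j     ≡⟨ cong (_* 1/[2+2j] j) (ℕ→ℚ-suc (suc (j ℕ.+ j))) ⟨
  ℕ→ℚ (suc (suc (j ℕ.+ j))) * 1/[2+2j] j      ≡⟨ ℕ→ℚ-suc-inverse (suc (j ℕ.+ j)) ⟩
  1ℚ                                          ∎
  where open ≡-Reasoning

κ : ℕ → ℚ
κ j = - (1/[1+2j] j * 1/[2+2j] j)

-- β j y = (-1)^j binom(y + j, 2j)
β : ℕ → ℚ → ℚ
β zero    y = 1ℚ
β (suc j) y = κ j * ((y + (ℕ→ℚ j + 1ℚ)) * ((y - ℕ→ℚ j) * β j y))

β-shift : ∀ j y → (y + 1ℚ - ℕ→ℚ j) * β j (y + 1ℚ) ≡ (y + ℕ→ℚ j + 1ℚ) * β j y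
β-shift zero    y = identity y
  where
  identity : ∀ y → (y + 1ℚ - 0ℚ) * 1ℚ ≡ (y + 0ℚ + 1ℚ) * 1ℚ
  identity = solve-∀ ℚ-ring
β-shift (suc j) y = begin
  (y + 1ℚ - ℕ→ℚ (suc j)) * β (suc j) (y + 1ℚ)
    ≡⟨ cong (λ J′ → (y + 1ℚ - J′) * β (suc j) (y + 1ℚ)) (ℕ→ℚ-suc j) ⟩
  (y + 1ℚ - (1ℚ + J)) * (κ j * ((y + 1ℚ + (J + 1ℚ)) * ((y + 1ℚ - J) * β j (y + 1ℚ))))
    ≡⟨ cong (λ e → (y + 1ℚ - (1ℚ + J)) * (κ j * ((y + 1ℚ + (J + 1ℚ)) * e))) (β-shift j y) ⟩
  (y + 1ℚ - (1ℚ + J)) * (κ j * ((y + 1ℚ + (J + 1ℚ)) * ((y + J + 1ℚ) * β j y)))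
    ≡⟨ identity (κ j) y J (β j y) ⟩
  (y + (1ℚ + J) + 1ℚ) * β (suc j) y
    ≡⟨ cong (λ J′ → (y + J′ + 1ℚ) * β (suc j) y) (ℕ→ℚ-suc j) ⟨
  (y + ℕ→ℚ (suc j) + 1ℚ) * β (suc j) y
    ∎
  where
  open ≡-Reasoning
  J : ℚ
  J = ℕ→ℚ j
  identity : ∀ k y J b → (y + 1ℚ - (1ℚ + J)) * (k * ((y + 1ℚ + (J + 1ℚ)) * ((y + J + 1ℚ) * b)))
                       ≡ (y + (1ℚ + J) + 1ℚ) * (k * ((y + (J + 1ℚ)) * ((y - J) * b)))
  identity = solve-∀ ℚ-ring

β-reflect : ∀ j y → β j (- 1ℚ - y) ≡ β j y
β-reflect zero    y = refl
β-reflect (suc j) y = begin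
  κ j * ((- 1ℚ - y + (J + 1ℚ)) * ((- 1ℚ - y - J) * β j (- 1ℚ - y)))
    ≡⟨ cong (λ e → κ j * ((- 1ℚ - y + (J + 1ℚ)) * ((- 1ℚ - y - J) * e))) (β-reflect j y) ⟩
  κ j * ((- 1ℚ - y + (J + 1ℚ)) * ((- 1ℚ - y - J) * β j y))
    ≡⟨ identity (κ j) y J (β j y) ⟩
  κ j * ((y + (J + 1ℚ)) * ((y - J) * β j y))
    ∎
  where
  open ≡-Reasoning
  J : ℚ
  J = ℕ→ℚ j
  identity : ∀ k y J b → k * ((- 1ℚ - y + (J + 1ℚ)) * ((- 1ℚ - y - J) * b))
                       ≡ k * ((y + (J + 1ℚ)) * ((y - J) * b))
  identity = solve-∀ ℚ-ring

β-suc-zero : ∀ j → β (suc j) 0ℚ ≡ 0ℚ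
β-suc-zero zero    = refl
β-suc-zero (suc j) = begin
  κ (suc j) * ((0ℚ + (J + 1ℚ)) * ((0ℚ - J) * β (suc j) 0ℚ))
    ≡⟨ cong (λ e → κ (suc j) * ((0ℚ + (J + 1ℚ)) * ((0ℚ - J) * e))) (β-suc-zero j) ⟩
  κ (suc j) * ((0ℚ + (J + 1ℚ)) * ((0ℚ - J) * 0ℚ))
    ≡⟨ identity (κ (suc j)) J ⟩
  0ℚ ∎
  where
  open ≡-Reasoning
  J : ℚ
  J = ℕ→ℚ (suc j)
  identity : ∀ k J → k * ((0ℚ + (J + 1ℚ)) * ((0ℚ - J) * 0ℚ)) ≡ 0ℚ
  identity = solve-∀ ℚ-ring

-- closed form of the partial sums  ∑_{w ≤ y} β j w
βpartial : ℕ → ℚ → ℚ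
βpartial j y = 1/[1+2j] j * ((y + (ℕ→ℚ j + 1ℚ)) * β j y)

β-suc-difference : ∀ j y → β (suc j) (y + 1ℚ) - β (suc j) y ≡ - βpartial j y
β-suc-difference j y = begin
  κ j * ((y + 1ℚ + (J + 1ℚ)) * ((y + 1ℚ - J) * β j (y + 1ℚ))) - β (suc j) y
    ≡⟨ cong (λ e → κ j * ((y + 1ℚ + (J + 1ℚ)) * e) - β (suc j) y) (β-shift j y) ⟩
  κ j * ((y + 1ℚ + (J + 1ℚ)) * ((y + J + 1ℚ) * β j y)) - β (suc j) y
    ≡⟨ identity (1/[1+2j] j) (1/[2+2j] j) y J (β j y) ⟩
  - (((1ℚ + (1ℚ + (J + J))) * 1/[2+2j] j) * βpartial j y)
    ≡⟨ cong (λ e → - (e * βpartial j y)) ([2+2j]*1/[2+2j] j) ⟩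
  - (1ℚ * βpartial j y)
    ≡⟨ cong -_ (ℚ.*-identityˡ (βpartial j y)) ⟩
  - βpartial j y
    ∎
  where
  open ≡-Reasoning
  J : ℚ
  J = ℕ→ℚ j
  identity : ∀ i₁ i₂ y J b →
    - (i₁ * i₂) * ((y + 1ℚ + (J + 1ℚ)) * ((y + J + 1ℚ) * b)) - - (i₁ * i₂) * ((y + (J + 1ℚ)) * ((y - J) * b))
    ≡ - (((1ℚ + (1ℚ + (J + J))) * i₂) * (i₁ * ((y + (J + 1ℚ)) * b)))
  identity = solve-∀ ℚ-ring

βpartial-difference : ∀ j y → βpartial j (y + 1ℚ) - βpartial j y ≡ β j (y + 1ℚ)
βpartial-difference j y = begin
  i₁ * ((y + 1ℚ + (J + 1ℚ)) * β j (y + 1ℚ)) - i₁ * ((y + (J + 1ℚ)) * β j y)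
    ≡⟨ cong (λ e → i₁ * ((y + 1ℚ + (J + 1ℚ)) * β j (y + 1ℚ)) - i₁ * e) shifted ⟩
  i₁ * ((y + 1ℚ + (J + 1ℚ)) * β j (y + 1ℚ)) - i₁ * ((y + 1ℚ - J) * β j (y + 1ℚ))
    ≡⟨ identity i₁ y J (β j (y + 1ℚ)) ⟩
  ((1ℚ + (J + J)) * i₁) * β j (y + 1ℚ)
    ≡⟨ cong (_* β j (y + 1ℚ)) ([1+2j]*1/[1+2j] j) ⟩
  1ℚ * β j (y + 1ℚ)
    ≡⟨ ℚ.*-identityˡ (β j (y + 1ℚ)) ⟩
  β j (y + 1ℚ)
    ∎
  where
  open ≡-Reasoning
  J : ℚ
  J = ℕ→ℚ j
  i₁ : ℚ
  i₁ = 1/[1+2j] j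
  assoc : ∀ y J → y + (J + 1ℚ) ≡ y + J + 1ℚ
  assoc = solve-∀ ℚ-ring
  shifted : (y + (J + 1ℚ)) * β j y ≡ (y + 1ℚ - J) * β j (y + 1ℚ)
  shifted = trans (cong (_* β j y) (assoc y J)) (sym (β-shift j y))
  identity : ∀ i y J b → i * ((y + 1ℚ + (J + 1ℚ)) * b) - i * ((y + 1ℚ - J) * b) ≡ ((1ℚ + (J + J)) * i) * b
  identity = solve-∀ ℚ-ring

βpartial-zero : ∀ j → βpartial j 0ℚ ≡ β j 0ℚ
βpartial-zero zero    = refl
βpartial-zero (suc j) = begin
  1/[1+2j] (suc j) * ((0ℚ + (ℕ→ℚ (suc j) + 1ℚ)) * β (suc j) 0ℚ)
    ≡⟨ cong (λ e → 1/[1+2j] (suc j) * ((0ℚ + (ℕ→ℚ (suc j) + 1ℚ)) * e)) (β-suc-zero j) ⟩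
  1/[1+2j] (suc j) * ((0ℚ + (ℕ→ℚ (suc j) + 1ℚ)) * 0ℚ)
    ≡⟨ identity (1/[1+2j] (suc j)) (ℕ→ℚ (suc j)) ⟩
  0ℚ
    ≡⟨ β-suc-zero j ⟨
  β (suc j) 0ℚ
    ∎
  where
  open ≡-Reasoning
  identity : ∀ i J → i * ((0ℚ + (J + 1ℚ)) * 0ℚ) ≡ 0ℚ
  identity = solve-∀ ℚ-ring

∑-β : ∀ j a → ∑[ w < suc a ] β j (ℕ→ℚ w) ≡ βpartial j (ℕ→ℚ a)
∑-β j zero    = trans (ℚ.+-identityʳ (β j 0ℚ)) (sym (βpartial-zero j))
∑-β j (suc a) = begin
  ∑[ w < suc (suc a) ] β j (ℕ→ℚ w)                   ≡⟨ ∑-init-last (suc a) (β j ∘ ℕ→ℚ) ⟩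
  ∑[ w < suc a ] β j (ℕ→ℚ w) + β j (ℕ→ℚ (suc a))     ≡⟨ cong₂ _+_ (∑-β j a) (cong (β j) (ℕ→ℚ-suc′ a)) ⟩
  βpartial j (ℕ→ℚ a) + β j (ℕ→ℚ a + 1ℚ)
                                                     ≡⟨ cong (λ e → βpartial j (ℕ→ℚ a) + e) (βpartial-difference j (ℕ→ℚ a)) ⟨
  βpartial j (ℕ→ℚ a) + (βpartial j (ℕ→ℚ a + 1ℚ) - βpartial j (ℕ→ℚ a))
                                                     ≡⟨ a+[b-a]≡b (βpartial j (ℕ→ℚ a)) (βpartial j (ℕ→ℚ a + 1ℚ)) ⟩
  βpartial j (ℕ→ℚ a + 1ℚ)                            ≡⟨ cong (βpartial j) (ℕ→ℚ-suc′ a) ⟨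
  βpartial j (ℕ→ℚ (suc a))                           ∎
  where
  open ≡-Reasoning
  a+[b-a]≡b : ∀ a b → a + (b - a) ≡ b
  a+[b-a]≡b = solve-∀ ℚ-ring

β-suc-∑ : ∀ j x → β (suc j) (ℕ→ℚ x) ≡ - ∑[ a < x ] βpartial j (ℕ→ℚ a)
β-suc-∑ j zero    = β-suc-zero j
β-suc-∑ j (suc x) = begin
  β (suc j) (ℕ→ℚ (suc x))                                     ≡⟨ cong (β (suc j)) (ℕ→ℚ-suc′ x) ⟩
  β (suc j) (ℕ→ℚ x + 1ℚ)
                                                              ≡⟨ a-b+b≡a (β (suc j) (ℕ→ℚ x + 1ℚ)) (β (suc j) (ℕ→ℚ x)) ⟨
  β (suc j) (ℕ→ℚ x + 1ℚ) - β (suc j) (ℕ→ℚ x) + β (suc j) (ℕ→ℚ x)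
                                                              ≡⟨ cong₂ _+_ (β-suc-difference j (ℕ→ℚ x)) (β-suc-∑ j x) ⟩
  - βpartial j (ℕ→ℚ x) + - ∑[ a < x ] βpartial j (ℕ→ℚ a)
                                                              ≡⟨ neg-sum (βpartial j (ℕ→ℚ x)) (∑[ a < x ] βpartial j (ℕ→ℚ a)) ⟩
  - (∑[ a < x ] βpartial j (ℕ→ℚ a) + βpartial j (ℕ→ℚ x))       ≡⟨ cong -_ (∑-init-last x (βpartial j ∘ ℕ→ℚ)) ⟨
  - ∑[ a < suc x ] βpartial j (ℕ→ℚ a)                          ∎
  where
  open ≡-Reasoning
  a-b+b≡a : ∀ a b → a - b + b ≡ a
  a-b+b≡a = solve-∀ ℚ-ring
  neg-sum : ∀ a b → - a + - b ≡ - (b + a)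
  neg-sum = solve-∀ ℚ-ring

β-suc-iterated-sum : ∀ j x → β (suc j) (ℕ→ℚ x) ≡ - ∑[ a < x ] ∑[ w < suc a ] β j (ℕ→ℚ w)
β-suc-iterated-sum j x =
  trans (β-suc-∑ j x) (cong -_ (∑-cong x (λ a _ → sym (∑-β j a))))

β½ : ℕ → ℚ
β½ j = β j -½

β½-recurrence : ∀ j → (ℕ→ℚ j + 1ℚ) * β½ (suc j) ≡ (+ 1 / 8) * ((ℕ→ℚ j + ℕ→ℚ j + 1ℚ) * β½ j)
β½-recurrence j = begin
  (J + 1ℚ) * (κ j * ((-½ + (J + 1ℚ)) * ((-½ - J) * β j -½)))
    ≡⟨ identity (1/[1+2j] j) (1/[2+2j] j) J (β j -½) ⟩
  (+ 1 / 8) * (((1ℚ + (1ℚ + (J + J))) * 1/[2+2j] j) * (((1ℚ + (J + J)) * 1/[1+2j] j) * ((J + J + 1ℚ) * β j -½)))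
    ≡⟨ cong₂ (λ a b → (+ 1 / 8) * (a * (b * ((J + J + 1ℚ) * β j -½)))) ([2+2j]*1/[2+2j] j) ([1+2j]*1/[1+2j] j) ⟩
  (+ 1 / 8) * (1ℚ * (1ℚ * ((J + J + 1ℚ) * β j -½)))
    ≡⟨ cong ((+ 1 / 8) *_) (trans (ℚ.*-identityˡ (1ℚ * ((J + J + 1ℚ) * β j -½)))
                                  (ℚ.*-identityˡ ((J + J + 1ℚ) * β j -½))) ⟩
  (+ 1 / 8) * ((J + J + 1ℚ) * β j -½)
    ∎
  where
  open ≡-Reasoning
  J : ℚ
  J = ℕ→ℚ j
  identity : ∀ i₁ i₂ J b → (J + 1ℚ) * (- (i₁ * i₂) * ((-½ + (J + 1ℚ)) * ((-½ - J) * b)))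
    ≡ (+ 1 / 8) * (((1ℚ + (1ℚ + (J + J))) * i₂) * (((1ℚ + (J + J)) * i₁) * ((J + J + 1ℚ) * b)))
  identity = solve-∀ ℚ-ring

X+_ : ℚ → Poly
X+ c = c ∷ 1ℚ ∷ []

eval-X+ : ∀ c y → eval (X+ c) y ≡ y + c
eval-X+ c y = identity c y
  where
  identity : ∀ c y → c + y * (1ℚ + y * 0ℚ) ≡ y + c
  identity = solve-∀ ℚ-ring

βPoly : ℕ → Poly
βPoly zero    = 1ℚ ∷ []
βPoly (suc j) = scaleP (κ j) (mulP (X+ (ℕ→ℚ j + 1ℚ)) (mulP (X+ (- ℕ→ℚ j)) (βPoly j)))

eval-βPoly : ∀ j y → eval (βPoly j) y ≡ β j y
eval-βPoly zero    y = identity y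
  where
  identity : ∀ y → 1ℚ + y * 0ℚ ≡ 1ℚ
  identity = solve-∀ ℚ-ring
eval-βPoly (suc j) y = begin
  eval (scaleP (κ j) (mulP (X+ (J + 1ℚ)) (mulP (X+ (- J)) (βPoly j)))) y
    ≡⟨ eval-scaleP (κ j) (mulP (X+ (J + 1ℚ)) (mulP (X+ (- J)) (βPoly j))) y ⟩
  κ j * eval (mulP (X+ (J + 1ℚ)) (mulP (X+ (- J)) (βPoly j))) y
    ≡⟨ cong (κ j *_) (eval-mulP (X+ (J + 1ℚ)) (mulP (X+ (- J)) (βPoly j)) y) ⟩
  κ j * (eval (X+ (J + 1ℚ)) y * eval (mulP (X+ (- J)) (βPoly j)) y)
    ≡⟨ cong (λ e → κ j * (eval (X+ (J + 1ℚ)) y * e)) (eval-mulP (X+ (- J)) (βPoly j) y) ⟩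
  κ j * (eval (X+ (J + 1ℚ)) y * (eval (X+ (- J)) y * eval (βPoly j) y))
    ≡⟨ cong₂ (λ a b → κ j * (a * b)) (eval-X+ (J + 1ℚ) y) (cong₂ _*_ (eval-X+ (- J) y) (eval-βPoly j y)) ⟩
  κ j * ((y + (J + 1ℚ)) * ((y - J) * β j y))
    ∎
  where
  open ≡-Reasoning
  J : ℚ
  J = ℕ→ℚ j

-- Counting zigzags

isPeak : Bool → ℕ → Bool
isPeak b zero    = b
isPeak b (suc n) = isPeak (not b) n

even≡isPeak : ∀ n → ((n % 2) ≡ᵇ 0) ≡ isPeak true n
even≡isPeak zero          = refl
even≡isPeak (suc zero)    = refl
even≡isPeak (suc (suc n)) = even≡isPeak n

adjacent : ∀ {m} → Fin m → Fin m → Bool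
adjacent i j = (toℕ i ≡ᵇ suc (toℕ j)) ∨ (suc (toℕ i) ≡ᵇ toℕ j)

-- the zigzag order on Fin m in which index 0 is a peak iff b
_≤[_]_ : ∀ {m} → Fin m → Bool → Fin m → Bool
i ≤[ b ] j = (toℕ i ≡ᵇ toℕ j) ∨ (isPeak b (toℕ j) ∧ adjacent i j)

allFinᵇ : ∀ n → (Fin n → Bool) → Bool
allFinᵇ zero    p = true
allFinᵇ (suc n) p = p fzero ∧ allFinᵇ n (p ∘ fsuc)

allFinᵇ-cong : ∀ n {p q : Fin n → Bool} → (∀ i → p i ≡ q i) → allFinᵇ n p ≡ allFinᵇ n q
allFinᵇ-cong zero    p≡q = refl
allFinᵇ-cong (suc n) p≡q = cong₂ _∧_ (p≡q fzero) (allFinᵇ-cong n (p≡q ∘ fsuc))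

allFinᵇ-true : ∀ n → allFinᵇ n (λ _ → true) ≡ true
allFinᵇ-true zero    = refl
allFinᵇ-true (suc n) = allFinᵇ-true n

allFinᵇ-∧ : ∀ n (p q : Fin n → Bool) → allFinᵇ n (λ i → p i ∧ q i) ≡ allFinᵇ n p ∧ allFinᵇ n q
allFinᵇ-∧ zero    p q = refl
allFinᵇ-∧ (suc n) p q = trans (cong ((p fzero ∧ q fzero) ∧_) (allFinᵇ-∧ n (p ∘ fsuc) (q ∘ fsuc)))
                              (interchange (p fzero) (q fzero) _ _)
  where
  interchange : ∀ a b c d → (a ∧ b) ∧ (c ∧ d) ≡ (a ∧ c) ∧ (b ∧ d)
  interchange true  b true  d = refl
  interchange true  b false d = ∧-zeroʳ b
  interchange false b c     d = refl

allᵇ-tabulate : ∀ n {A : Set} (p : A → Bool) (f : Fin n → A) → allᵇ p (tabulate f) ≡ allFinᵇ n (p ∘ f)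
allᵇ-tabulate zero    p f = refl
allᵇ-tabulate (suc n) p f = cong (p (f fzero) ∧_) (allᵇ-tabulate n p (f ∘ fsuc))

isMonotone : ∀ {t m} → Bool → Vec (Fin t) m → Bool
isMonotone {m = m} b f = allFinᵇ m λ i → allFinᵇ m λ j →
  not (i ≤[ b ] j) ∨ (toℕ (lookup f i) ≤ᵇ toℕ (lookup f j))

isOrderPreserving≡isMonotone : ∀ {t m} (f : Vec (Fin t) m) → isOrderPreserving f ≡ isMonotone true f
isOrderPreserving≡isMonotone {m = m} f =
  trans (allᵇ-tabulate m _ (λ i → i)) (allFinᵇ-cong m λ i →
    trans (allᵇ-tabulate m _ (λ j → j)) (allFinᵇ-cong m λ j →
      cong (λ peak → not ((toℕ i ≡ᵇ toℕ j) ∨ (peak ∧ adjacent i j)) ∨ (toℕ (lookup f i) ≤ᵇ toℕ (lookup f j)))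
           (even≡isPeak (toℕ j))))

stepᵇ : Bool → ℕ → ℕ → Bool
stepᵇ down x y = if down then y ≤ᵇ x else x ≤ᵇ y

isZigzag : ∀ {t m} → Bool → Vec (Fin t) m → Bool
isZigzag down []ᵛ               = true
isZigzag down (x ∷ᵛ []ᵛ)         = true
isZigzag down (x ∷ᵛ y ∷ᵛ f)      = stepᵇ down (toℕ x) (toℕ y) ∧ isZigzag (not down) (y ∷ᵛ f)

≤ᵇ-refl : ∀ n → (n ≤ᵇ n) ≡ true
≤ᵇ-refl n = Equivalence.to T-≡ (ℕ.≤⇒≤ᵇ (ℕ.≤-refl {n}))

isMonotone-∷∷ : ∀ {t m} b (x y : Fin t) (g : Vec (Fin t) m) →
  isMonotone b (x ∷ᵛ y ∷ᵛ g) ≡ stepᵇ b (toℕ x) (toℕ y) ∧ isMonotone (not b) (y ∷ᵛ g)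
isMonotone-∷∷ {t} {m} b x y g = begin
  isMonotone b (x ∷ᵛ y ∷ᵛ g)
    ≡⟨ cong₂ _∧_ (cong₂ _∧_ (≤ᵇ-refl (toℕ x)) (cong (E fzero (fsuc fzero) ∧_) row₀-tail))
                 (allFinᵇ-∧ (suc m) (λ i → E (fsuc i) fzero) (λ i → allFinᵇ (suc m) (E (fsuc i) ∘ fsuc))) ⟩
  (true ∧ (E fzero (fsuc fzero) ∧ true)) ∧ (allFinᵇ (suc m) (λ i → E (fsuc i) fzero) ∧ isMonotone (not b) (y ∷ᵛ g))
    ≡⟨ cong (λ c → (true ∧ (E fzero (fsuc fzero) ∧ true)) ∧ ((E (fsuc fzero) fzero ∧ c) ∧ isMonotone (not b) (y ∷ᵛ g)))
            column₀-tail ⟩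
  (true ∧ (E fzero (fsuc fzero) ∧ true)) ∧ ((E (fsuc fzero) fzero ∧ true) ∧ isMonotone (not b) (y ∷ᵛ g))
    ≡⟨ first-step b (toℕ x) (toℕ y) (isMonotone (not b) (y ∷ᵛ g)) ⟩
  stepᵇ b (toℕ x) (toℕ y) ∧ isMonotone (not b) (y ∷ᵛ g)
    ∎
  where
  open ≡-Reasoning
  f : Vec (Fin t) (suc (suc m))
  f = x ∷ᵛ y ∷ᵛ g
  E : Fin (suc (suc m)) → Fin (suc (suc m)) → Bool
  E i j = not (i ≤[ b ] j) ∨ (toℕ (lookup f i) ≤ᵇ toℕ (lookup f j))
  row₀-tail : allFinᵇ m (λ j → E fzero (fsuc (fsuc j))) ≡ true
  row₀-tail = trans (allFinᵇ-cong m λ j → cong (λ a → not a ∨ (toℕ x ≤ᵇ toℕ (lookup g j)))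
                                                 (∧-zeroʳ (isPeak (not (not b)) (toℕ j))))
                    (allFinᵇ-true m)
  column₀-tail : allFinᵇ m (λ i → E (fsuc (fsuc i)) fzero) ≡ true
  column₀-tail = trans (allFinᵇ-cong m λ i → cong (λ a → not a ∨ (toℕ (lookup g i) ≤ᵇ toℕ x)) (∧-zeroʳ b))
                       (allFinᵇ-true m)
  first-step : ∀ b x y M →
    (true ∧ ((not (not b ∧ true) ∨ (x ≤ᵇ y)) ∧ true)) ∧ (((not (b ∧ true) ∨ (y ≤ᵇ x)) ∧ true) ∧ M) ≡ stepᵇ b x y ∧ M
  first-step true  x y M = cong (_∧ M) (∧-identityʳ (y ≤ᵇ x))
  first-step false x y M = cong (_∧ M) (∧-identityʳ (x ≤ᵇ y))

isMonotone≡isZigzag : ∀ {t m} b (f : Vec (Fin t) m) → isMonotone b f ≡ isZigzag b f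
isMonotone≡isZigzag b []ᵛ           = refl
isMonotone≡isZigzag b (x ∷ᵛ []ᵛ)     = cong (λ c → (c ∧ true) ∧ true) (≤ᵇ-refl (toℕ x))
isMonotone≡isZigzag b (x ∷ᵛ y ∷ᵛ g)  =
  trans (isMonotone-∷∷ b x y g) (cong (stepᵇ b (toℕ x) (toℕ y) ∧_) (isMonotone≡isZigzag (not b) (y ∷ᵛ g)))

countℚ : ∀ {A : Set} → (A → Bool) → List A → ℚ
countℚ p xs = ℕ→ℚ (length (filterᵇ p xs))

countℚ-++ : ∀ {A : Set} (p : A → Bool) xs ys → countℚ p (xs ++ ys) ≡ countℚ p xs + countℚ p ys
countℚ-++ p xs ys = begin
  ℕ→ℚ (length (filterᵇ p (xs ++ ys)))                     ≡⟨ cong (ℕ→ℚ ∘ length) (filter-++ (T? ∘ p) xs ys) ⟩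
  ℕ→ℚ (length (filterᵇ p xs ++ filterᵇ p ys))             ≡⟨ cong ℕ→ℚ (length-++ (filterᵇ p xs)) ⟩
  ℕ→ℚ (length (filterᵇ p xs) ℕ.+ length (filterᵇ p ys))   ≡⟨ ℕ→ℚ-+ (length (filterᵇ p xs)) _ ⟩
  countℚ p xs + countℚ p ys                               ∎
  where open ≡-Reasoning

countℚ-concat : ∀ {A : Set} (p : A → Bool) xss → countℚ p (concat xss) ≡ sumℚ (map (countℚ p) xss)
countℚ-concat p []         = refl
countℚ-concat p (xs ∷ xss) =
  trans (countℚ-++ p xs (concat xss)) (cong (λ e → countℚ p xs + e) (countℚ-concat p xss))

length-filterᵇ-map : ∀ {A B : Set} (p : B → Bool) (f : A → B) xs →
  length (filterᵇ p (map f xs)) ≡ length (filterᵇ (p ∘ f) xs)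
length-filterᵇ-map p f []       = refl
length-filterᵇ-map p f (x ∷ xs) with p (f x)
... | true  = cong suc (length-filterᵇ-map p f xs)
... | false = length-filterᵇ-map p f xs

length-filterᵇ-cong : ∀ {A : Set} {p q : A → Bool} → (∀ a → p a ≡ q a) → ∀ xs →
  length (filterᵇ p xs) ≡ length (filterᵇ q xs)
length-filterᵇ-cong         p≡q []       = refl
length-filterᵇ-cong {p = p} {q} p≡q (x ∷ xs) with p x | q x | p≡q x
... | true  | .true  | refl = cong suc (length-filterᵇ-cong p≡q xs)
... | false | .false | refl = length-filterᵇ-cong p≡q xs

length-filterᵇ-false : ∀ {A : Set} (xs : List A) → length (filterᵇ (λ _ → false) xs) ≡ 0
length-filterᵇ-false []       = refl
length-filterᵇ-false (x ∷ xs) = length-filterᵇ-false xs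

countℚ-∧ : ∀ {A : Set} c (p : A → Bool) xs → countℚ (λ a → c ∧ p a) xs ≡ (if c then countℚ p xs else 0ℚ)
countℚ-∧ true  p xs = refl
countℚ-∧ false p xs = cong ℕ→ℚ (length-filterᵇ-false xs)

sumℚ-allFin : ∀ n (h : ℕ → ℚ) → sumℚ (map (h ∘ toℕ) (allFin n)) ≡ ∑< n h
sumℚ-allFin n h = trans (cong sumℚ (map-tabulate {n = n} (λ i → i) (h ∘ toℕ))) (sumℚ-tabulate n h)
  where
  sumℚ-tabulate : ∀ n (h : ℕ → ℚ) → sumℚ (tabulate {n = n} (h ∘ toℕ)) ≡ ∑< n h
  sumℚ-tabulate zero    h = refl
  sumℚ-tabulate (suc n) h = cong (λ e → h 0 + e) (sumℚ-tabulate n (h ∘ suc))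

countℚ-allMaps-suc : ∀ t m (p : Vec (Fin t) (suc m) → Bool) →
  countℚ p (allMaps t (suc m)) ≡ sumℚ (map (λ x → countℚ (p ∘ (x ∷ᵛ_)) (allMaps t m)) (allFin t))
countℚ-allMaps-suc t m p = begin
  countℚ p (concat (map extend (allFin t)))                 ≡⟨ countℚ-concat p (map extend (allFin t)) ⟩
  sumℚ (map (countℚ p) (map extend (allFin t)))            ≡⟨ cong sumℚ (map-∘ (allFin t)) ⟨
  sumℚ (map (countℚ p ∘ extend) (allFin t))
    ≡⟨ cong sumℚ (map-cong (λ x → cong ℕ→ℚ (length-filterᵇ-map p (x ∷ᵛ_) (allMaps t m))) (allFin t)) ⟩
  sumℚ (map (λ x → countℚ (p ∘ (x ∷ᵛ_)) (allMaps t m)) (allFin t)) ∎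
  where
  open ≡-Reasoning
  extend : Fin t → List (Vec (Fin t) (suc m))
  extend x = map (x ∷ᵛ_) (allMaps t m)

-- the number of g : Vec (Fin t) m for which x ∷ g is a zigzag whose first step goes down iff `down`
zigzags : ℕ → Bool → ℕ → ℕ → ℚ
zigzags t down zero    x = 1ℚ
zigzags t down (suc m) x = ∑[ y < t ] (if stepᵇ down x y then zigzags t (not down) m y else 0ℚ)

countℚ-isZigzag : ∀ t down m (x : Fin t) →
  countℚ (λ g → isZigzag down (x ∷ᵛ g)) (allMaps t m) ≡ zigzags t down m (toℕ x)
countℚ-isZigzag t down zero    x = refl
countℚ-isZigzag t down (suc m) x = begin
  countℚ (λ g → isZigzag down (x ∷ᵛ g)) (allMaps t (suc m))
    ≡⟨ countℚ-allMaps-suc t m (λ g → isZigzag down (x ∷ᵛ g)) ⟩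
  sumℚ (map (λ y → countℚ (λ g → step y ∧ isZigzag (not down) (y ∷ᵛ g)) (allMaps t m)) (allFin t))
    ≡⟨ cong sumℚ (map-cong (λ y → trans (countℚ-∧ (step y) _ (allMaps t m))
                                        (cong (if step y then_else 0ℚ) (countℚ-isZigzag t (not down) m y))) (allFin t)) ⟩
  sumℚ (map (λ y → if step y then zigzags t (not down) m (toℕ y) else 0ℚ) (allFin t))
    ≡⟨ sumℚ-allFin t (λ y → if stepᵇ down (toℕ x) y then zigzags t (not down) m y else 0ℚ) ⟩
  zigzags t down (suc m) (toℕ x)
    ∎
  where
  open ≡-Reasoning
  step : Fin t → Bool
  step y = stepᵇ down (toℕ x) (toℕ y)

ΩZcount-suc : ∀ m t → ℕ→ℚ (ΩZcount (suc m) t) ≡ ∑[ x < t ] zigzags t true m x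
ΩZcount-suc m t = begin
  countℚ isOrderPreserving (allMaps t (suc m))
    ≡⟨ cong ℕ→ℚ (length-filterᵇ-cong (λ f → trans (isOrderPreserving≡isMonotone f) (isMonotone≡isZigzag true f))
                                     (allMaps t (suc m))) ⟩
  countℚ (isZigzag true) (allMaps t (suc m))
    ≡⟨ countℚ-allMaps-suc t m (isZigzag true) ⟩
  sumℚ (map (λ x → countℚ (λ g → isZigzag true (x ∷ᵛ g)) (allMaps t m)) (allFin t))
    ≡⟨ cong sumℚ (map-cong (countℚ-isZigzag t true m) (allFin t)) ⟩
  sumℚ (map (zigzags t true m ∘ toℕ) (allFin t))
    ≡⟨ sumℚ-allFin t (zigzags t true m) ⟩
  ∑[ x < t ] zigzags t true m x
    ∎
  where open ≡-Reasoning

≤ᵇ-suc : ∀ w z → (suc w ≤ᵇ suc z) ≡ (w ≤ᵇ z)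
≤ᵇ-suc zero    z = refl
≤ᵇ-suc (suc w) z = refl

∑-indicator-≤ : ∀ n a (f : ℕ → ℚ) → a ℕ.< n → ∑[ y < n ] (if y ≤ᵇ a then f y else 0ℚ) ≡ ∑< (suc a) f
∑-indicator-≤ (suc n) zero    f _         = cong (λ e → f 0 + e) (∑-zero n)
∑-indicator-≤ (suc n) (suc a) f (s≤s a<n) = cong (λ e → f 0 + e) (begin
  ∑[ y < n ] (if suc y ≤ᵇ suc a then f (suc y) else 0ℚ)
    ≡⟨ ∑-cong n (λ y _ → cong (if_then f (suc y) else 0ℚ) (≤ᵇ-suc y a)) ⟩
  ∑[ y < n ] (if y ≤ᵇ a then f (suc y) else 0ℚ)
    ≡⟨ ∑-indicator-≤ n a (f ∘ suc) a<n ⟩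
  ∑< (suc a) (f ∘ suc)
    ∎)
  where open ≡-Reasoning

∑-indicator-≥ : ∀ n w (f : ℕ → ℚ) → w ℕ.≤ n → ∑[ z < n ] (if w ≤ᵇ z then f z else 0ℚ) ≡ ∑< n f - ∑< w f
∑-indicator-≥ n       zero    f _         = sym (a-0≡a (∑< n f))
  where
  a-0≡a : ∀ a → a - 0ℚ ≡ a
  a-0≡a = solve-∀ ℚ-ring
∑-indicator-≥ (suc n) (suc w) f (s≤s w≤n) = begin
  0ℚ + ∑[ z < n ] (if suc w ≤ᵇ suc z then f (suc z) else 0ℚ)
    ≡⟨ cong (λ e → 0ℚ + e) (∑-cong n (λ z _ → cong (if_then f (suc z) else 0ℚ) (≤ᵇ-suc w z))) ⟩
  0ℚ + ∑[ z < n ] (if w ≤ᵇ z then f (suc z) else 0ℚ)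
    ≡⟨ cong (λ e → 0ℚ + e) (∑-indicator-≥ n w (f ∘ suc) w≤n) ⟩
  0ℚ + (∑< n (f ∘ suc) - ∑< w (f ∘ suc))
    ≡⟨ identity (f 0) (∑< n (f ∘ suc)) (∑< w (f ∘ suc)) ⟩
  (f 0 + ∑< n (f ∘ suc)) - (f 0 + ∑< w (f ∘ suc))
    ∎
  where
  open ≡-Reasoning
  identity : ∀ a b c → 0ℚ + (b - c) ≡ (a + b) - (a + c)
  identity = solve-∀ ℚ-ring

zigzags-down : ∀ t m a → a ℕ.< t → zigzags t true (suc m) a ≡ ∑[ v < suc a ] zigzags t false m v
zigzags-down t m a = ∑-indicator-≤ t a (zigzags t false m)

zigzags-up : ∀ t m w → w ℕ.≤ t →
  zigzags t false (suc m) w ≡ ℕ→ℚ (ΩZcount (suc m) t) - ∑[ z < w ] zigzags t true m z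
zigzags-up t m w w≤t = trans (∑-indicator-≥ t w (zigzags t true m) w≤t)
                             (cong (_- ∑< w (zigzags t true m)) (sym (ΩZcount-suc m t)))

Ωeven : ℕ → ℕ → ℚ
Ωeven t k = ℕ→ℚ (ΩZcount (2 ℕ.* k) t)

2*suc : ∀ k → 2 ℕ.* suc k ≡ suc (suc (2 ℕ.* k))
2*suc k = ℕ.*-suc 2 k

zigzags-even : ∀ t k w → w ℕ.≤ t → zigzags t false (2 ℕ.* k) w ≡ ((λ j → β j (ℕ→ℚ w)) ⋆ Ωeven t) k
zigzags-even t zero    w _   = refl
zigzags-even t (suc k) w w≤t = begin
  zigzags t false (2 ℕ.* suc k) w
    ≡⟨ cong (λ m → zigzags t false m w) (2*suc k) ⟩
  zigzags t false (suc (suc (2 ℕ.* k))) w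
    ≡⟨ zigzags-up t (suc (2 ℕ.* k)) w w≤t ⟩
  ℕ→ℚ (ΩZcount (suc (suc (2 ℕ.* k))) t) - ∑[ a < w ] zigzags t true (suc (2 ℕ.* k)) a
    ≡⟨ cong₂ _-_ (cong (λ m → ℕ→ℚ (ΩZcount m t)) (sym (2*suc k))) (∑-cong w λ a a<w →
         trans (zigzags-down t (2 ℕ.* k) a (ℕ.<-≤-trans a<w w≤t))
               (∑-cong (suc a) λ v v≤a →
                  zigzags-even t k v (ℕ.≤-trans (ℕ.≤-pred v≤a) (ℕ.≤-trans (ℕ.<⇒≤ a<w) w≤t)))) ⟩
  Ω (suc k) - ∑[ a < w ] ∑[ v < suc a ] ((λ j → β j (ℕ→ℚ v)) ⋆ Ω) k
    ≡⟨ cong (λ e → Ω (suc k) - e) (trans (∑-cong w (λ a _ → ∑-⋆ (suc a) (λ v j → β j (ℕ→ℚ v)) Ω k))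
                                  (∑-⋆ w (λ a j → ∑[ v < suc a ] β j (ℕ→ℚ v)) Ω k)) ⟩
  Ω (suc k) - (S ⋆ Ω) k
    ≡⟨ identity (Ω (suc k)) ((S ⋆ Ω) k) ⟩
  1ℚ * Ω (suc k) + - 1ℚ * (S ⋆ Ω) k
    ≡⟨ cong (λ e → 1ℚ * Ω (suc k) + e) (⋆-assoc-scalar (- 1ℚ) S Ω k) ⟨
  1ℚ * Ω (suc k) + ((λ j → - 1ℚ * S j) ⋆ Ω) k
    ≡⟨ cong (λ e → 1ℚ * Ω (suc k) + e) (⋆-congˡ Ω k λ j _ →
         trans (-1*a≡-a (S j)) (sym (β-suc-iterated-sum j w))) ⟩
  1ℚ * Ω (suc k) + ((λ j → β (suc j) (ℕ→ℚ w)) ⋆ Ω) k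
    ∎
  where
  open ≡-Reasoning
  Ω : ℕ → ℚ
  Ω = Ωeven t
  S : ℕ → ℚ
  S j = ∑[ a < w ] ∑[ v < suc a ] β j (ℕ→ℚ v)
  identity : ∀ a b → a - b ≡ 1ℚ * a + - 1ℚ * b
  identity = solve-∀ ℚ-ring
  -1*a≡-a : ∀ a → - 1ℚ * a ≡ - a
  -1*a≡-a = solve-∀ ℚ-ring

Ωeven-recurrence : ∀ t k → ((λ j → β j (ℕ→ℚ t)) ⋆ Ωeven t) (suc k) ≡ 0ℚ
Ωeven-recurrence t k = begin
  ((λ j → β j (ℕ→ℚ t)) ⋆ Ωeven t) (suc k)
    ≡⟨ zigzags-even t (suc k) t ℕ.≤-refl ⟨
  zigzags t false (2 ℕ.* suc k) t
    ≡⟨ cong (λ m → zigzags t false m t) (2*suc k) ⟩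
  zigzags t false (suc (suc (2 ℕ.* k))) t
    ≡⟨ zigzags-up t (suc (2 ℕ.* k)) t ℕ.≤-refl ⟩
  ℕ→ℚ (ΩZcount (suc (suc (2 ℕ.* k))) t) - ∑[ z < t ] zigzags t true (suc (2 ℕ.* k)) z
    ≡⟨ cong (_- ∑[ z < t ] zigzags t true (suc (2 ℕ.* k)) z) (ΩZcount-suc (suc (2 ℕ.* k)) t) ⟩
  ∑[ z < t ] zigzags t true (suc (2 ℕ.* k)) z - ∑[ z < t ] zigzags t true (suc (2 ℕ.* k)) z
    ≡⟨ ℚ.+-inverseʳ (∑[ z < t ] zigzags t true (suc (2 ℕ.* k)) z) ⟩
  0ℚ
    ∎
  where open ≡-Reasoning

-- The order polynomials

sumP : ℕ → (ℕ → Poly) → Poly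
sumP zero    f = []
sumP (suc n) f = addP (f 0) (sumP n (f ∘ suc))

eval-sumP : ∀ n f y → eval (sumP n f) y ≡ ∑[ i < n ] eval (f i) y
eval-sumP zero    f y = refl
eval-sumP (suc n) f y =
  trans (eval-addP (f 0) (sumP n (f ∘ suc)) y) (cong (λ e → eval (f 0) y + e) (eval-sumP n (f ∘ suc) y))

sumP-cong : ∀ n {f g : ℕ → Poly} → (∀ i → i ℕ.< n → f i ≡ g i) → sumP n f ≡ sumP n g
sumP-cong zero    f≡g = refl
sumP-cong (suc n) f≡g = cong₂ addP (f≡g 0 (s≤s z≤n)) (sumP-cong n (λ i i<n → f≡g (suc i) (s≤s i<n)))

-- The second argument is fuel: the recursion  P (k + 1) = - ∑_{i ≤ k} βPoly (i + 1) · P (k - i)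
-- is not structural, and the result does not depend on the fuel once it is at least k.
orderPolyWithFuel : ℕ → ℕ → Poly
orderPolyWithFuel zero    _          = 1ℚ ∷ []
orderPolyWithFuel (suc k) zero       = []
orderPolyWithFuel (suc k) (suc fuel) =
  scaleP (- 1ℚ) (sumP (suc k) λ i → mulP (βPoly (suc i)) (orderPolyWithFuel (k ∸ i) fuel))

orderPolyWithFuel-irrelevant : ∀ k fuel fuel′ → k ℕ.≤ fuel → k ℕ.≤ fuel′ →
  orderPolyWithFuel k fuel ≡ orderPolyWithFuel k fuel′
orderPolyWithFuel-irrelevant zero    _          _           _           _            = refl
orderPolyWithFuel-irrelevant (suc k) (suc fuel) (suc fuel′) (s≤s k≤fuel) (s≤s k≤fuel′) =
  cong (scaleP (- 1ℚ)) (sumP-cong (suc k) λ i _ → cong (mulP (βPoly (suc i)))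
    (orderPolyWithFuel-irrelevant (k ∸ i) fuel fuel′
      (ℕ.≤-trans (ℕ.m∸n≤m k i) k≤fuel) (ℕ.≤-trans (ℕ.m∸n≤m k i) k≤fuel′)))

orderPoly : ℕ → Poly
orderPoly k = orderPolyWithFuel k k

orderPoly-zero : ∀ y → eval (orderPoly 0) y ≡ 1ℚ
orderPoly-zero y = identity y
  where
  identity : ∀ y → 1ℚ + y * 0ℚ ≡ 1ℚ
  identity = solve-∀ ℚ-ring

orderPoly-recurrence : ∀ y k → ((λ j → β j y) ⋆ (λ n → eval (orderPoly n) y)) (suc k) ≡ 0ℚ
orderPoly-recurrence y k = begin
  1ℚ * P (suc k) + X
    ≡⟨ cong (λ e → 1ℚ * e + X) P-suc ⟩
  1ℚ * (- 1ℚ * X) + X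
    ≡⟨ identity X ⟩
  0ℚ
    ∎
  where
  open ≡-Reasoning
  P : ℕ → ℚ
  P n = eval (orderPoly n) y
  X : ℚ
  X = ((λ j → β (suc j) y) ⋆ P) k
  identity : ∀ x → 1ℚ * (- 1ℚ * x) + x ≡ 0ℚ
  identity = solve-∀ ℚ-ring
  summand : ℕ → Poly
  summand i = mulP (βPoly (suc i)) (orderPolyWithFuel (k ∸ i) k)
  P-suc : P (suc k) ≡ - 1ℚ * X
  P-suc = trans (eval-scaleP (- 1ℚ) (sumP (suc k) summand) y) (cong (- 1ℚ *_)
    (trans (eval-sumP (suc k) summand y) (∑-cong (suc k) λ i _ →
      trans (eval-mulP (βPoly (suc i)) (orderPolyWithFuel (k ∸ i) k) y)
            (cong₂ _*_ (eval-βPoly (suc i) y)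
                       (cong (λ p → eval p y) (orderPolyWithFuel-irrelevant (k ∸ i) k (k ∸ i) (ℕ.m∸n≤m k i) ℕ.≤-refl))))))

orderPoly-counts : ∀ t k → eval (orderPoly k) (ℕ→ℚ t) ≡ Ωeven t k
orderPoly-counts t = ⋆-inverse-unique (λ j → β j (ℕ→ℚ t)) _ (Ωeven t) refl (orderPoly-zero (ℕ→ℚ t))
  (orderPoly-recurrence (ℕ→ℚ t)) (Ωeven-recurrence t)

orderPoly-reflect : ∀ y k → eval (orderPoly k) (- 1ℚ - y) ≡ eval (orderPoly k) y
orderPoly-reflect y = ⋆-inverse-unique (λ j → β j y) _ _ refl
  (trans (orderPoly-zero (- 1ℚ - y)) (sym (orderPoly-zero y)))
  (λ k → trans (⋆-congˡ (λ n → eval (orderPoly n) (- 1ℚ - y)) (suc k) (λ j _ → sym (β-reflect j y)))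
               (orderPoly-recurrence (- 1ℚ - y) k))
  (orderPoly-recurrence y)

-- Power series and the value at -1/2

module _ (a : ℕ → ℚ) where

  private
    -- the coefficients of z A′(z) A(z)
    K : ℕ → ℚ
    K = (λ i → ℕ→ℚ i * a i) ⋆ a

    K-double : ∀ n → K n + K n ≡ ℕ→ℚ n * (a ⋆ a) n
    K-double n = begin
      K n + K n
        ≡⟨ cong (λ e → K n + e) (⋆-comm (λ i → ℕ→ℚ i * a i) a n) ⟩
      K n + (a ⋆ (λ i → ℕ→ℚ i * a i)) n
        ≡⟨ ∑-distrib-+ (suc n) (λ i → ℕ→ℚ i * a i * a (n ∸ i)) (λ i → a i * (ℕ→ℚ (n ∸ i) * a (n ∸ i))) ⟨
      ∑[ i < suc n ] (ℕ→ℚ i * a i * a (n ∸ i) + a i * (ℕ→ℚ (n ∸ i) * a (n ∸ i)))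
        ≡⟨ ∑-cong (suc n) (λ i i≤n → trans (identity (ℕ→ℚ i) (ℕ→ℚ (n ∸ i)) (a i) (a (n ∸ i)))
                                             (cong (λ e → e * (a i * a (n ∸ i))) (i+[n-i]≡n i (ℕ.≤-pred i≤n)))) ⟩
      ∑[ i < suc n ] (ℕ→ℚ n * (a i * a (n ∸ i)))
        ≡⟨ ∑-distribˡ (suc n) (λ i → a i * a (n ∸ i)) (ℕ→ℚ n) ⟩
      ℕ→ℚ n * (a ⋆ a) n
        ∎
      where
      open ≡-Reasoning
      identity : ∀ x y u v → x * u * v + u * (y * v) ≡ (x + y) * (u * v)
      identity = solve-∀ ℚ-ring
      i+[n-i]≡n : ∀ i → i ℕ.≤ n → ℕ→ℚ i + ℕ→ℚ (n ∸ i) ≡ ℕ→ℚ n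
      i+[n-i]≡n i i≤n = trans (sym (ℕ→ℚ-+ i (n ∸ i))) (cong ℕ→ℚ (ℕ.m+[n∸m]≡n i≤n))

    K-suc : ∀ c → (∀ j → (ℕ→ℚ j + 1ℚ) * a (suc j) ≡ c * ((ℕ→ℚ j + ℕ→ℚ j + 1ℚ) * a j)) →
      ∀ n → K (suc n) ≡ c * (K n + K n + (a ⋆ a) n)
    K-suc c a-rec n = begin
      0ℚ * a 0 * a (suc n) + ((λ i → ℕ→ℚ (suc i) * a (suc i)) ⋆ a) n
        ≡⟨ cong₂ _+_ (identity₀ (a 0) (a (suc n)))
                     (⋆-congˡ a n λ i _ → trans (cong (_* a (suc i)) (ℕ→ℚ-suc′ i)) (a-rec i)) ⟩
      0ℚ + ((λ i → c * ((ℕ→ℚ i + ℕ→ℚ i + 1ℚ) * a i)) ⋆ a) n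
        ≡⟨ trans (ℚ.+-identityˡ _) (⋆-assoc-scalar c (λ i → (ℕ→ℚ i + ℕ→ℚ i + 1ℚ) * a i) a n) ⟩
      c * ((λ i → (ℕ→ℚ i + ℕ→ℚ i + 1ℚ) * a i) ⋆ a) n
        ≡⟨ cong (c *_) (trans (⋆-congˡ a n (λ i _ → expand (ℕ→ℚ i) (a i)))
                       (trans (⋆-distribʳ-+ (λ i → ℕ→ℚ i * a i + ℕ→ℚ i * a i) a a n)
                              (cong (_+ (a ⋆ a) n) (⋆-distribʳ-+ (λ i → ℕ→ℚ i * a i) (λ i → ℕ→ℚ i * a i) a n)))) ⟩
      c * (K n + K n + (a ⋆ a) n)
        ∎
      where
      open ≡-Reasoning
      identity₀ : ∀ u v → 0ℚ * u * v ≡ 0ℚ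
      identity₀ = solve-∀ ℚ-ring
      expand : ∀ x u → (x + x + 1ℚ) * u ≡ (x * u + x * u) + u
      expand = solve-∀ ℚ-ring

  -- (j + 1) a (j + 1) = c (2j + 1) a j  says  (1 - 2cz) A′ = c A,  so that  A² = 1 / (1 - 2cz)
  ⋆-self-geometric : ∀ c → (∀ j → (ℕ→ℚ j + 1ℚ) * a (suc j) ≡ c * ((ℕ→ℚ j + ℕ→ℚ j + 1ℚ) * a j)) →
    ∀ n → (a ⋆ a) (suc n) ≡ (c + c) * (a ⋆ a) n
  ⋆-self-geometric c a-rec n = begin
    S (suc n)                                   ≡⟨ a-b+b≡a (S (suc n)) ((c + c) * S n) ⟨
    (S (suc n) - (c + c) * S n) + (c + c) * S n  ≡⟨ cong (_+ (c + c) * S n) (ℕ→ℚ-suc-cancel n _ scaled-difference≡0) ⟩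
    0ℚ + (c + c) * S n                          ≡⟨ ℚ.+-identityˡ _ ⟩
    (c + c) * S n                               ∎
    where
    open ≡-Reasoning
    S : ℕ → ℚ
    S = a ⋆ a
    N : ℚ
    N = ℕ→ℚ n
    a-b+b≡a : ∀ a b → a - b + b ≡ a
    a-b+b≡a = solve-∀ ℚ-ring
    distribute : ∀ m x y → m * (x - y) ≡ m * x - m * y
    distribute = solve-∀ ℚ-ring
    cancel : ∀ c N s → c * (N * s + s) + c * (N * s + s) - (1ℚ + N) * ((c + c) * s) ≡ 0ℚ
    cancel = solve-∀ ℚ-ring
    scaled-difference≡0 : ℕ→ℚ (suc n) * (S (suc n) - (c + c) * S n) ≡ 0ℚ
    scaled-difference≡0 = begin
      ℕ→ℚ (suc n) * (S (suc n) - (c + c) * S n)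
        ≡⟨ distribute (ℕ→ℚ (suc n)) (S (suc n)) ((c + c) * S n) ⟩
      ℕ→ℚ (suc n) * S (suc n) - ℕ→ℚ (suc n) * ((c + c) * S n)
        ≡⟨ cong₂ (λ x m → x - m * ((c + c) * S n)) (sym (K-double (suc n))) (ℕ→ℚ-suc n) ⟩
      K (suc n) + K (suc n) - (1ℚ + N) * ((c + c) * S n)
        ≡⟨ cong (λ k → k + k - (1ℚ + N) * ((c + c) * S n)) (K-suc c a-rec n) ⟩
      c * (K n + K n + S n) + c * (K n + K n + S n) - (1ℚ + N) * ((c + c) * S n)
        ≡⟨ cong (λ k → c * (k + S n) + c * (k + S n) - (1ℚ + N) * ((c + c) * S n)) (K-double n) ⟩
      c * (N * S n + S n) + c * (N * S n + S n) - (1ℚ + N) * ((c + c) * S n)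
        ≡⟨ cancel c N (S n) ⟩
      0ℚ
        ∎

shift : (ℕ → ℚ) → ℕ → ℚ
shift a zero    = 0ℚ
shift a (suc n) = a n

shift-⋆ : ∀ a f k → (shift a ⋆ f) (suc k) ≡ (a ⋆ f) k
shift-⋆ a f k = trans (cong (_+ (a ⋆ f) k) (ℚ.*-zeroˡ (f (suc k)))) (ℚ.+-identityˡ ((a ⋆ f) k))

-- the coefficients of (1 - r z) A(z)
mulOneMinus : ℚ → (ℕ → ℚ) → ℕ → ℚ
mulOneMinus r a n = a n + (- r) * shift a n

mulOneMinus-⋆ : ∀ r a f m → (mulOneMinus r a ⋆ f) m ≡ (a ⋆ f) m + (- r) * (shift a ⋆ f) m
mulOneMinus-⋆ r a f m = trans (⋆-distribʳ-+ a (λ n → (- r) * shift a n) f m)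
                              (cong (λ e → (a ⋆ f) m + e) (⋆-assoc-scalar (- r) (shift a) f m))

module _ (a : ℕ → ℚ) (r : ℚ) (a₀≡1 : a 0 ≡ 1ℚ) (a⋆a-geometric : ∀ n → (a ⋆ a) (suc n) ≡ r * (a ⋆ a) n) where

  private
    b : ℕ → ℚ
    b = mulOneMinus r a

  mulOneMinus-zero : b 0 ≡ 1ℚ
  mulOneMinus-zero = trans (cong (λ e → e + (- r) * 0ℚ) a₀≡1) (identity r)
    where
    identity : ∀ r → 1ℚ + (- r) * 0ℚ ≡ 1ℚ
    identity = solve-∀ ℚ-ring

  mulOneMinus-inverse : ∀ k → (a ⋆ b) (suc k) ≡ 0ℚ
  mulOneMinus-inverse k = begin
    (a ⋆ b) (suc k)                                     ≡⟨ ⋆-comm a b (suc k) ⟩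
    (b ⋆ a) (suc k)                                     ≡⟨ mulOneMinus-⋆ r a a (suc k) ⟩
    (a ⋆ a) (suc k) + (- r) * (shift a ⋆ a) (suc k)     ≡⟨ cong₂ (λ x y → x + (- r) * y) (a⋆a-geometric k) (shift-⋆ a a k) ⟩
    r * (a ⋆ a) k + (- r) * (a ⋆ a) k                   ≡⟨ identity r ((a ⋆ a) k) ⟩
    0ℚ                                                  ∎
    where
    open ≡-Reasoning
    identity : ∀ r s → r * s + (- r) * s ≡ 0ℚ
    identity = solve-∀ ℚ-ring

  private
    mulOneMinus-⋆-self-suc : ∀ k → (b ⋆ b) (suc k) ≡ (- r) * (a ⋆ b) k
    mulOneMinus-⋆-self-suc k = begin
      (b ⋆ b) (suc k)                                   ≡⟨ mulOneMinus-⋆ r a b (suc k) ⟩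
      (a ⋆ b) (suc k) + (- r) * (shift a ⋆ b) (suc k)
                                                        ≡⟨ cong₂ (λ x y → x + (- r) * y) (mulOneMinus-inverse k) (shift-⋆ a b k) ⟩
      0ℚ + (- r) * (a ⋆ b) k                            ≡⟨ ℚ.+-identityˡ _ ⟩
      (- r) * (a ⋆ b) k                                 ∎
      where open ≡-Reasoning

  mulOneMinus-⋆-self-0 : (b ⋆ b) 0 ≡ 1ℚ
  mulOneMinus-⋆-self-0 = cong (λ e → e * e + 0ℚ) mulOneMinus-zero

  mulOneMinus-⋆-self-1 : (b ⋆ b) 1 ≡ - r
  mulOneMinus-⋆-self-1 = begin
    (b ⋆ b) 1                ≡⟨ mulOneMinus-⋆-self-suc 0 ⟩
    (- r) * (a 0 * b 0 + 0ℚ) ≡⟨ cong₂ (λ x y → (- r) * (x * y + 0ℚ)) a₀≡1 mulOneMinus-zero ⟩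
    (- r) * (1ℚ * 1ℚ + 0ℚ)   ≡⟨ ℚ.*-identityʳ (- r) ⟩
    - r                      ∎
    where open ≡-Reasoning

  mulOneMinus-⋆-self-2+ : ∀ k → (b ⋆ b) (suc (suc k)) ≡ 0ℚ
  mulOneMinus-⋆-self-2+ k =
    trans (mulOneMinus-⋆-self-suc (suc k)) (trans (cong ((- r) *_) (mulOneMinus-inverse k)) (ℚ.*-zeroʳ (- r)))

-- the coefficients of A(z²)
spread : (ℕ → ℚ) → ℕ → ℚ
spread f zero          = f 0
spread f (suc zero)    = 0ℚ
spread f (suc (suc n)) = spread (f ∘ suc) n

spread-double : ∀ f n → spread f (2 ℕ.* n) ≡ f n
spread-double f zero    = refl
spread-double f (suc n) = trans (cong (spread f) (2*suc n)) (spread-double (f ∘ suc) n)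

spread-zero : ∀ f → (∀ n → f n ≡ 0ℚ) → ∀ m → spread f m ≡ 0ℚ
spread-zero f f≡0 zero          = f≡0 0
spread-zero f f≡0 (suc zero)    = refl
spread-zero f f≡0 (suc (suc m)) = spread-zero (f ∘ suc) (f≡0 ∘ suc) m

spread-linear : ∀ s f g m → spread (λ n → s * f n + g n) m ≡ s * spread f m + spread g m
spread-linear s f g zero          = refl
spread-linear s f g (suc zero)    = identity s
  where
  identity : ∀ s → 0ℚ ≡ s * 0ℚ + 0ℚ
  identity = solve-∀ ℚ-ring
spread-linear s f g (suc (suc m)) = spread-linear s (f ∘ suc) (g ∘ suc) m

⋆-spread : ∀ f g m → (spread f ⋆ spread g) m ≡ spread (f ⋆ g) m
⋆-spread f g zero          = refl
⋆-spread f g (suc zero)    = identity (f 0) (g 0)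
  where
  identity : ∀ u v → u * 0ℚ + (0ℚ * v + 0ℚ) ≡ 0ℚ
  identity = solve-∀ ℚ-ring
⋆-spread f g (suc (suc m)) = begin
  f 0 * spread (g ∘ suc) m + (0ℚ * spread g (suc m) + (spread (f ∘ suc) ⋆ spread g) m)
    ≡⟨ cong (λ e → f 0 * spread (g ∘ suc) m + (0ℚ * spread g (suc m) + e)) (⋆-spread (f ∘ suc) g m) ⟩
  f 0 * spread (g ∘ suc) m + (0ℚ * spread g (suc m) + spread ((f ∘ suc) ⋆ g) m)
    ≡⟨ identity (f 0 * spread (g ∘ suc) m) (spread g (suc m)) (spread ((f ∘ suc) ⋆ g) m) ⟩
  f 0 * spread (g ∘ suc) m + spread ((f ∘ suc) ⋆ g) m
    ≡⟨ spread-linear (f 0) (g ∘ suc) ((f ∘ suc) ⋆ g) m ⟨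
  spread ((f ⋆ g) ∘ suc) m
    ∎
  where
  open ≡-Reasoning
  identity : ∀ x y z → x + (0ℚ * y + z) ≡ x + z
  identity = solve-∀ ℚ-ring

length-sqrtCoeffs : ∀ k → length (sqrtCoeffs k) ≡ suc k
length-sqrtCoeffs zero    = refl
length-sqrtCoeffs (suc k) =
  trans (length-++ (sqrtCoeffs k)) (trans (cong (ℕ._+ 1) (length-sqrtCoeffs k)) (ℕ.+-comm (suc k) 1))

coeff-++-< : ∀ xs (a : ℚ) i → i ℕ.< length xs → coeff (xs ++ [ a ]) i ≡ coeff xs i
coeff-++-< (x ∷ xs) a zero    _         = refl
coeff-++-< (x ∷ xs) a (suc i) (s≤s i<n) = coeff-++-< xs a i i<n

coeff-++-length : ∀ xs (a : ℚ) → coeff (xs ++ [ a ]) (length xs) ≡ a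
coeff-++-length []       a = refl
coeff-++-length (x ∷ xs) a = coeff-++-length xs a

sumℚ-applyUpTo : ∀ k (f : ℕ → ℕ) (h : ℕ → ℚ) → sumℚ (map h (map suc (applyUpTo f k))) ≡ ∑[ i < k ] h (suc (f i))
sumℚ-applyUpTo zero    f h = refl
sumℚ-applyUpTo (suc k) f h = cong (λ e → h (suc (f 0)) + e) (sumℚ-applyUpTo k (f ∘ suc) h)

sqrtCoeffs-unique : ∀ s → s 0 ≡ 1ℚ → (∀ m → (s ⋆ s) m ≡ radicand m) →
  ∀ k i → i ℕ.≤ k → coeff (sqrtCoeffs k) i ≡ s i
sqrtCoeffs-unique s s₀≡1 s⋆s≡radicand zero    zero    z≤n  = sym s₀≡1
sqrtCoeffs-unique s s₀≡1 s⋆s≡radicand (suc k) i       i≤1+k with ℕ.m≤n⇒m<n∨m≡n i≤1+k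
... | inj₁ i<1+k = trans (coeff-++-< (sqrtCoeffs k) _ i (subst (i ℕ.<_) (sym (length-sqrtCoeffs k)) i<1+k))
                         (sqrtCoeffs-unique s s₀≡1 s⋆s≡radicand k i (ℕ.≤-pred i<1+k))
... | inj₂ refl  = begin
  coeff (sqrtCoeffs k ++ [ new ]) (suc k)       ≡⟨ cong (coeff (sqrtCoeffs k ++ [ new ])) (length-sqrtCoeffs k) ⟨
  coeff (sqrtCoeffs k ++ [ new ]) (length (sqrtCoeffs k)) ≡⟨ coeff-++-length (sqrtCoeffs k) new ⟩
  ½ * (radicand (suc k) - products)           ≡⟨ cong₂ (λ x y → ½ * (x - y)) radicand-suc products≡M ⟩
  ½ * ((1ℚ * s (suc k) + (M + s (suc k) * 1ℚ)) - M) ≡⟨ solve-for (s (suc k)) M ⟩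
  s (suc k)                                   ∎
  where
  open ≡-Reasoning
  prev : List ℚ
  prev = sqrtCoeffs k
  products : ℚ
  products = sumℚ (map (λ i → coeff prev i * coeff prev (suc k ∸ i)) (map suc (upTo k)))
  new : ℚ
  new = ½ * (radicand (suc k) - products)
  M : ℚ
  M = ∑[ i < k ] (s (suc i) * s (k ∸ i))
  products≡M : products ≡ M
  products≡M = trans (sumℚ-applyUpTo k (λ i → i) (λ i → coeff prev i * coeff prev (suc k ∸ i)))
    (∑-cong k λ i i<k → cong₂ _*_ (sqrtCoeffs-unique s s₀≡1 s⋆s≡radicand k (suc i) i<k)
                                  (sqrtCoeffs-unique s s₀≡1 s⋆s≡radicand k (k ∸ i) (ℕ.m∸n≤m k i)))
  radicand-suc : radicand (suc k) ≡ 1ℚ * s (suc k) + (M + s (suc k) * 1ℚ)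
  radicand-suc = begin
    radicand (suc k)                               ≡⟨ s⋆s≡radicand (suc k) ⟨
    s 0 * s (suc k) + ((s ∘ suc) ⋆ s) k
      ≡⟨ cong₂ (λ x y → x * s (suc k) + y) s₀≡1 (∑-init-last k (λ i → s (suc i) * s (k ∸ i))) ⟩
    1ℚ * s (suc k) + (M + s (suc k) * s (k ∸ k))   ≡⟨ cong (λ j → 1ℚ * s (suc k) + (M + s (suc k) * s j)) (ℕ.n∸n≡0 k) ⟩
    1ℚ * s (suc k) + (M + s (suc k) * s 0)         ≡⟨ cong (λ x → 1ℚ * s (suc k) + (M + s (suc k) * x)) s₀≡1 ⟩
    1ℚ * s (suc k) + (M + s (suc k) * 1ℚ)          ∎
  solve-for : ∀ x m → ½ * ((1ℚ * x + (m + x * 1ℚ)) - m) ≡ x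
  solve-for = solve-∀ ℚ-ring

β½-⋆-self-geometric : ∀ n → (β½ ⋆ β½) (suc n) ≡ (+ 1 / 4) * (β½ ⋆ β½) n
β½-⋆-self-geometric = ⋆-self-geometric β½ (+ 1 / 8) β½-recurrence

-- the coefficients of √(1 - z/4) = (1 - z/4) (1 - z/4)^(-1/2)
sqrtSeries : ℕ → ℚ
sqrtSeries = mulOneMinus (+ 1 / 4) β½

spread-sqrtSeries-⋆-self : ∀ m → (spread sqrtSeries ⋆ spread sqrtSeries) m ≡ radicand m
spread-sqrtSeries-⋆-self m = trans (⋆-spread sqrtSeries sqrtSeries m) (spread-square m)
  where
  square-0 : (sqrtSeries ⋆ sqrtSeries) 0 ≡ 1ℚ
  square-0 = mulOneMinus-⋆-self-0 β½ (+ 1 / 4) refl β½-⋆-self-geometric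
  square-1 : (sqrtSeries ⋆ sqrtSeries) 1 ≡ - (+ 1 / 4)
  square-1 = mulOneMinus-⋆-self-1 β½ (+ 1 / 4) refl β½-⋆-self-geometric
  square-2+ : ∀ k → (sqrtSeries ⋆ sqrtSeries) (suc (suc k)) ≡ 0ℚ
  square-2+ = mulOneMinus-⋆-self-2+ β½ (+ 1 / 4) refl β½-⋆-self-geometric
  spread-square : ∀ m → spread (sqrtSeries ⋆ sqrtSeries) m ≡ radicand m
  spread-square zero                      = square-0
  spread-square (suc zero)                = refl
  spread-square (suc (suc zero))          = square-1
  spread-square (suc (suc (suc zero)))    = refl
  spread-square (suc (suc (suc (suc m)))) = spread-zero _ square-2+ m

R-double : ∀ n → R (2 ℕ.* n) ≡ sqrtSeries n
R-double n = trans (sqrtCoeffs-unique (spread sqrtSeries) refl spread-sqrtSeries-⋆-self (2 ℕ.* n) (2 ℕ.* n) ℕ.≤-refl)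
                   (spread-double sqrtSeries n)

orderPoly-at-½ : ∀ n → eval (orderPoly n) -½ ≡ sqrtSeries n
orderPoly-at-½ = ⋆-inverse-unique β½ _ sqrtSeries refl
  (trans (orderPoly-zero -½) (sym (mulOneMinus-zero β½ (+ 1 / 4) refl β½-⋆-self-geometric)))
  (orderPoly-recurrence -½) (mulOneMinus-inverse β½ (+ 1 / 4) refl β½-⋆-self-geometric)

shiftHalf-even : ∀ p → (∀ y → eval p (- 1ℚ - y) ≡ eval p y) → ∀ x → eval (shiftHalf p) (- x) ≡ eval (shiftHalf p) x
shiftHalf-even p p-symmetric x = begin
  eval (shiftHalf p) (- x)    ≡⟨ eval-shiftHalf p (- x) ⟩
  eval p (- x + -½)           ≡⟨ cong (eval p) (reflect x) ⟩
  eval p (- 1ℚ - (x + -½))    ≡⟨ p-symmetric (x + -½) ⟩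
  eval p (x + -½)             ≡⟨ eval-shiftHalf p x ⟨
  eval (shiftHalf p) x        ∎
  where
  open ≡-Reasoning
  reflect : ∀ x → - x + -½ ≡ - 1ℚ - (x + -½)
  reflect = solve-∀ ℚ-ring

orderPoly-IsOrderPolyZ : ∀ n → IsOrderPolyZ (2 ℕ.* n) (orderPoly n)
orderPoly-IsOrderPolyZ n t _ = orderPoly-counts t n

IsOrderPolyZ-unique : ∀ m p q → IsOrderPolyZ m p → IsOrderPolyZ m q → ∀ x → eval p x ≡ eval q x
IsOrderPolyZ-unique m p q p-counts q-counts =
  eval-unique p q 1 (λ t 1≤t → trans (p-counts t 1≤t) (sym (q-counts t 1≤t)))

lemma4p6 : (n : ℕ) → 1 ℕ.≤ n →
    Σ Poly (IsOrderPolyZ (2 ℕ.* n))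
    × ((p : Poly) → IsOrderPolyZ (2 ℕ.* n) p →
         (coeff (shiftHalf p) 0 ≡ R (2 ℕ.* n)) × (coeff (shiftHalf p) 1 ≡ 0ℚ))
lemma4p6 n _ = (orderPoly n , orderPoly-IsOrderPolyZ n) , coefficients
  where
  coefficients : (p : Poly) → IsOrderPolyZ (2 ℕ.* n) p →
    (coeff (shiftHalf p) 0 ≡ R (2 ℕ.* n)) × (coeff (shiftHalf p) 1 ≡ 0ℚ)
  coefficients p p-counts = constant , linear
    where
    p≗P : ∀ x → eval p x ≡ eval (orderPoly n) x
    p≗P = IsOrderPolyZ-unique (2 ℕ.* n) p (orderPoly n) p-counts (orderPoly-IsOrderPolyZ n)
    constant : coeff (shiftHalf p) 0 ≡ R (2 ℕ.* n)
    constant = begin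
      coeff (shiftHalf p) 0    ≡⟨ coeff-zero-eval (shiftHalf p) ⟩
      eval (shiftHalf p) 0ℚ    ≡⟨ eval-shiftHalf p 0ℚ ⟩
      eval p -½                ≡⟨ p≗P -½ ⟩
      eval (orderPoly n) -½    ≡⟨ orderPoly-at-½ n ⟩
      sqrtSeries n             ≡⟨ R-double n ⟨
      R (2 ℕ.* n)              ∎
      where open ≡-Reasoning
    linear : coeff (shiftHalf p) 1 ≡ 0ℚ
    linear = even⇒coeff1≡0 (shiftHalf p) (shiftHalf-even p λ y →
      trans (p≗P (- 1ℚ - y)) (trans (orderPoly-reflect y n) (sym (p≗P y))))
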